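{- Let $m\ge 2$ and $n=2^m-1$. Let $C$ be a binary linear completely regular code of length $n$ with minimum distance $d=3$, covering radius $\rho=3$ and intersection array $(n,b_1,1;1,c_2,n)$. Suppose the dual code $C^{\perp}$ has exactly three nonzero weights $w_1<w_2<w_3$. Then the extended code $C^*$ is completely regular with covering radius $\rho^*=4$ and intersection array $(n+1,n,b_1,1;1,c_2,n,n+1)$ if and only if $$w_1+w_3=2w_2=n+1.$$
   Context: For $\mathbf{x}\in\mathbb{F}_2^n$ and a code $C\subseteq\mathbb{F}_2^n$, $d(\mathbf{x},C)$ is the minimum Hamming distance from $\mathbf{x}$ to a codeword; the covering radius $\rho$ is $\max_{\mathbf{x}} d(\mathbf{x},C)$, and $C(l)=\{\mathbf{x}: d(\mathbf{x},C)=l\}$. A code $C$ with covering radius $\rho$ is completely regular if for every $l\ge 0$ each $\mathbf{x}\in C(l)$ has the same number $c_l$ of neighbours (vectors at Hamming distance $1$) in $C(l-1)$ and the same number $b_l$ of neighbours in $C(l+1)$; its intersection array is $(b_0,\dots,b_{\rho-1};c_1,\dots,c_\rho)$. The extended code $C^*$ is obtained from $C$ by appending an overall parity-check coordinate to every codeword. -}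

module Defs where

open import Data.Bool using (Bool; true; false; not; _∧_; _∨_; _xor_; if_then_else_)
open import Data.Nat using (ℕ; zero; suc; _+_; _⊓_; _⊔_; _≡ᵇ_)
open import Data.List using (List; []; _∷_; map; _++_; foldr; length; filterᵇ; allFin)
open import Data.Vec using (Vec; []; _∷_; zipWith; replicate; init; last; _∷ʳ_; _[_]%=_)
open import Data.Fin using (Fin)
open import Data.Product using (_×_; Σ; ∃)
open import Relation.Binary.PropositionalEquality using (_≡_; _≢_)

Word : ℕ → Set
Word n = Vec Bool n

Code : ℕ → Set
Code n = Word n → Bool

allWords : (n : ℕ) → List (Word n)
allWords zero    = [] ∷ []
allWords (suc n) = map (false ∷_) (allWords n) ++ map (true ∷_) (allWords n)

zeroWord : (n : ℕ) → Word n
zeroWord n = replicate n false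

_⊕_ : ∀ {n} → Word n → Word n → Word n
_⊕_ = zipWith _xor_

weight : ∀ {n} → Word n → ℕ
weight []          = 0
weight (true  ∷ x) = suc (weight x)
weight (false ∷ x) = weight x

dist : ∀ {n} → Word n → Word n → ℕ
dist x y = weight (x ⊕ y)

dot : ∀ {n} → Word n → Word n → Bool
dot []      []      = false
dot (a ∷ x) (b ∷ y) = (a ∧ b) xor dot x y

-- d(x,C) = min { dist x c : c ∈ C }.  (Equals the true minimum whenever C is
-- nonempty, which holds for linear codes; the default suc n is never attained.)
distToCode : ∀ {n} → Code n → Word n → ℕ
distToCode {n} C x =
  foldr (λ y acc → if C y then dist x y ⊓ acc else acc) (suc n) (allWords n)

coveringRadius : ∀ {n} → Code n → ℕ
coveringRadius {n} C = foldr (λ x acc → distToCode C x ⊔ acc) 0 (allWords n)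

IsLinear : ∀ {n} → Code n → Set
IsLinear {n} C = (C (zeroWord n) ≡ true)
               × (∀ x y → C x ≡ true → C y ≡ true → C (x ⊕ y) ≡ true)

HasMinDistance : ∀ {n} → Code n → ℕ → Set
HasMinDistance {n} C d =
    (Σ (Word n) λ x → Σ (Word n) λ y →
       C x ≡ true × C y ≡ true × x ≢ y × dist x y ≡ d)
  × (∀ x y → C x ≡ true → C y ≡ true → x ≢ y → d Data.Nat.≤ dist x y)

neighboursIn : ∀ {n} → Code n → Word n → ℕ → ℕ
neighboursIn {n} C x l =
  length (filterᵇ (λ i → distToCode C (x [ i ]%= not) ≡ᵇ l) (allFin n))

-- Entry k (0-based) of a list (default 0; only used in range).
at : List ℕ → ℕ → ℕ
at []       k       = 0
at (a ∷ as) zero    = a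
at (a ∷ as) (suc k) = at as k

-- C is completely regular with intersection array (b_0,…,b_{ρ-1}; c_1,…,c_ρ),
-- ρ the covering radius of C: bs = [b_0,…,b_{ρ-1}], cs = [c_1,…,c_ρ].
-- Every x ∈ C(l) has exactly c_l neighbours in C(l-1) (l ≥ 1) and exactly
-- b_l neighbours in C(l+1) (l < ρ).  (For l = 0 resp. l = ρ these sets are
-- empty, so the counts c_0 = 0, b_ρ = 0 are automatic.)
IsCompletelyRegularWithArray : ∀ {n} → Code n → List ℕ → List ℕ → Set
IsCompletelyRegularWithArray C bs cs =
    length bs ≡ coveringRadius C
  × length cs ≡ coveringRadius C
  × (∀ x l → distToCode C x ≡ l →
        (l Data.Nat.< coveringRadius C → neighboursIn C x (suc l) ≡ at bs l)
      × (∀ k → l ≡ suc k → neighboursIn C x k ≡ at cs k))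

dual : ∀ {n} → Code n → Code n
dual {n} C y = foldr (λ x acc → (not (C x) ∨ not (dot x y)) ∧ acc) true (allWords n)

HasExactlyThreeNonzeroWeights : ∀ {n} → Code n → ℕ → ℕ → ℕ → Set
HasExactlyThreeNonzeroWeights {n} C w₁ w₂ w₃ =
    w₁ Data.Nat.< w₂ × w₂ Data.Nat.< w₃
  × (∀ y → C y ≡ true → y ≢ zeroWord n →
        (weight y ≡ w₁) Data.Sum.⊎ ((weight y ≡ w₂) Data.Sum.⊎ (weight y ≡ w₃)))
  × (Σ (Word n) λ y → C y ≡ true × y ≢ zeroWord n × weight y ≡ w₁)
  × (Σ (Word n) λ y → C y ≡ true × y ≢ zeroWord n × weight y ≡ w₂)
  × (Σ (Word n) λ y → C y ≡ true × y ≢ zeroWord n × weight y ≡ w₃)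
  where import Data.Sum

parity : ∀ {n} → Word n → Bool
parity []      = false
parity (a ∷ x) = a xor parity x

extendedCode : ∀ {n} → Code n → Code (suc n)
extendedCode C z = C (init z) ∧ not (last z xor parity (init z))

-- For u in the dual code, the character sums F l = Σ_{x ∈ C(l)} (-1)^(u·x) form an eigenvector of
-- the 4×4 quotient matrix of the distance partition of C, for the eigenvalue θ(u) = n - 2 wt(u),
-- and F 0 = |C| ≠ 0.  So θ(u) is a root of the characteristic polynomial, which is (t - n) times a
-- cubic depending on b₁ + c₂; the three nonzero dual weights give its three distinct roots, and
-- Vieta turns b₁ + c₂ = n + 1 into w₁ + w₃ = 2 w₂ = n + 1 and back.  On the other side, the
-- distance of x ∷ʳ p to C* is d(x,C) plus one exactly when p disagrees with the parity of the
-- nearest codewords, so the neighbour counts of C* are read off from those of C: they match the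
-- array (n+1, n, b₁, 1; 1, c₂, n, n+1) exactly when b₁ + c₂ = n + 1.
module Submission where

open import Defs
open import Data.Bool using (true)
open import Data.Nat using (ℕ)
open import Data.List using (_∷_; [])
open import Relation.Binary.PropositionalEquality using (_≡_)

module Words where

  open import Data.Bool using (true; false; not)
  open import Data.Bool.Properties using (not-distribˡ-xor)
  open import Data.Nat using (suc; _≤_; z≤n; s≤s)
  open import Data.Nat.Properties using (≤-refl; m≤n⇒m≤1+n; n≤1+n)
  open import Data.Fin using (Fin) renaming (zero to fzero; suc to fsuc)
  open import Data.Vec using ([]; _∷_)
  open import Data.List using (map)
  open import Data.List.Membership.Propositional using (_∈_)
  open import Data.List.Membership.Propositional.Properties using (∈-++⁺ˡ; ∈-++⁺ʳ; ∈-map⁺)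
  open import Data.List.Relation.Unary.Any using (here)
  open import Relation.Binary.PropositionalEquality using (_≡_; refl; cong; sym)

  toggle : ∀ {n} → Word n → Fin n → Word n
  toggle x i = x Data.Vec.[ i ]%= not

  toggle-⊕ : ∀ {n} (x c : Word n) i → toggle x i ⊕ c ≡ toggle (x ⊕ c) i
  toggle-⊕ (a ∷ x) (b ∷ c) fzero    = cong (_∷ _) (sym (not-distribˡ-xor a b))
  toggle-⊕ (a ∷ x) (b ∷ c) (fsuc i) = cong (_ ∷_) (toggle-⊕ x c i)

  toggle-involutive : ∀ {n} (x : Word n) i → toggle (toggle x i) i ≡ x
  toggle-involutive (false ∷ x) fzero    = refl
  toggle-involutive (true  ∷ x) fzero    = refl
  toggle-involutive (a ∷ x)     (fsuc i) = cong (a ∷_) (toggle-involutive x i)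

  weight-toggle≤ : ∀ {n} (y : Word n) i → weight (toggle y i) ≤ suc (weight y)
  weight-toggle≤ (false ∷ y) fzero    = ≤-refl
  weight-toggle≤ (true  ∷ y) fzero    = m≤n⇒m≤1+n (n≤1+n _)
  weight-toggle≤ (false ∷ y) (fsuc i) = weight-toggle≤ y i
  weight-toggle≤ (true  ∷ y) (fsuc i) = s≤s (weight-toggle≤ y i)

  weight≤length : ∀ {n} (y : Word n) → weight y ≤ n
  weight≤length []          = z≤n
  weight≤length (false ∷ y) = m≤n⇒m≤1+n (weight≤length y)
  weight≤length (true  ∷ y) = s≤s (weight≤length y)

  weight≡0⇒≡zeroWord : ∀ {n} (x : Word n) → weight x ≡ 0 → x ≡ zeroWord n
  weight≡0⇒≡zeroWord []          _  = refl
  weight≡0⇒≡zeroWord (false ∷ x) eq = cong (false ∷_) (weight≡0⇒≡zeroWord x eq)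

  dist-self : ∀ {n} (x : Word n) → dist x x ≡ 0
  dist-self []          = refl
  dist-self (false ∷ x) = dist-self x
  dist-self (true  ∷ x) = dist-self x

  dist≡0⇒≡ : ∀ {n} (x c : Word n) → dist x c ≡ 0 → x ≡ c
  dist≡0⇒≡ []          []          _  = refl
  dist≡0⇒≡ (false ∷ x) (false ∷ c) eq = cong (false ∷_) (dist≡0⇒≡ x c eq)
  dist≡0⇒≡ (true  ∷ x) (true  ∷ c) eq = cong (true ∷_) (dist≡0⇒≡ x c eq)

  dist-toggle≤ : ∀ {n} (x c : Word n) i → dist (toggle x i) c ≤ suc (dist x c)
  dist-toggle≤ x c i rewrite toggle-⊕ x c i = weight-toggle≤ (x ⊕ c) i

  ∈-allWords : ∀ {n} (x : Word n) → x ∈ allWords n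
  ∈-allWords []                = here refl
  ∈-allWords {suc n} (false ∷ x) = ∈-++⁺ˡ (∈-map⁺ (false ∷_) (∈-allWords x))
  ∈-allWords {suc n} (true  ∷ x) =
    ∈-++⁺ʳ (map (false ∷_) (allWords n)) (∈-map⁺ (true ∷_) (∈-allWords x))

module Levels where

  open Words
  open import Data.Bool using (Bool; true; false; if_then_else_; T)
  open import Data.Nat using (ℕ; zero; suc; _+_; _*_; _⊓_; _⊔_; _≡ᵇ_; _≤_; _<_; z≤n; s≤s)
  open import Data.Nat.Properties
  open import Data.Nat.Tactic.RingSolver using (solve-∀)
  open import Data.List using (List; []; _∷_; foldr; length; filterᵇ; tabulate)
  open import Data.List.Membership.Propositional using (_∈_)
  open import Data.List.Relation.Unary.Any using (here; there)
  open import Data.Fin using (Fin) renaming (zero to fzero; suc to fsuc)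
  open import Data.Product using (_×_; _,_; ∃)
  open import Data.Sum using (_⊎_; inj₁; inj₂)
  open import Data.Empty using (⊥-elim)
  open import Relation.Binary.PropositionalEquality
  open import Algebra.Properties.Semiring.Sum +-*-semiring
    using (sum; sum-cong-≗; ∑-distrib-+; *-distribˡ-sum)

  module _ {n : ℕ} (C : Code n) (x : Word n) where

    private
      step : Word n → ℕ → ℕ
      step y acc = if C y then dist x y ⊓ acc else acc

      foldr-step≤ : ∀ ys {c} → c ∈ ys → C c ≡ true → foldr step (suc n) ys ≤ dist x c
      foldr-step≤ (y ∷ ys) (here refl) Cc rewrite Cc = m⊓n≤m _ _
      foldr-step≤ (y ∷ ys) (there c∈ys) Cc with C y
      ... | true  = ≤-trans (m⊓n≤n _ _) (foldr-step≤ ys c∈ys Cc)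
      ... | false = foldr-step≤ ys c∈ys Cc

      foldr-step-sel : ∀ ys → foldr step (suc n) ys ≡ suc n
                                ⊎ ∃ λ c → C c ≡ true × foldr step (suc n) ys ≡ dist x c
      foldr-step-sel []       = inj₁ refl
      foldr-step-sel (y ∷ ys) with C y in Cy
      ... | false = foldr-step-sel ys
      ... | true with ⊓-sel (dist x y) (foldr step (suc n) ys)
      ...   | inj₁ eq = inj₂ (y , Cy , eq)
      ...   | inj₂ eq rewrite eq = foldr-step-sel ys

    distToCode≤dist : ∀ c → C c ≡ true → distToCode C x ≤ dist x c
    distToCode≤dist c Cc = foldr-step≤ (allWords n) (∈-allWords c) Cc

    distToCode-attained : ∀ {c₀} → C c₀ ≡ true → ∃ λ c → C c ≡ true × distToCode C x ≡ dist x c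
    distToCode-attained {c₀} Cc₀ with foldr-step-sel (allWords n)
    ... | inj₂ attained = attained
    ... | inj₁ eq = ⊥-elim (<⇒≱ (s≤s (weight≤length (x ⊕ c₀)))
                                (subst (_≤ dist x c₀) eq (distToCode≤dist c₀ Cc₀)))

    distToCode-minimum : ∀ k {c₀} → C c₀ ≡ true → dist x c₀ ≡ k →
                         (∀ c → C c ≡ true → k ≤ dist x c) → distToCode C x ≡ k
    distToCode-minimum k Cc₀ refl lower with distToCode-attained Cc₀
    ... | c , Cc , eq = ≤-antisym (distToCode≤dist _ Cc₀) (subst (k ≤_) (sym eq) (lower c Cc))

  module _ {n : ℕ} (C : Code n) {c₀ : Word n} (Cc₀ : C c₀ ≡ true) where

    distToCode-toggle≤ : ∀ x i → distToCode C (toggle x i) ≤ suc (distToCode C x)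
    distToCode-toggle≤ x i with distToCode-attained C x Cc₀
    ... | c , Cc , eq = ≤-trans (distToCode≤dist C (toggle x i) c Cc)
                                (subst (λ d → dist (toggle x i) c ≤ suc d) (sym eq) (dist-toggle≤ x c i))

    distToCode≤toggle : ∀ x i → distToCode C x ≤ suc (distToCode C (toggle x i))
    distToCode≤toggle x i =
      subst (λ y → distToCode C y ≤ suc (distToCode C (toggle x i)))
            (toggle-involutive x i) (distToCode-toggle≤ (toggle x i) i)

    distToCode≡0⇒∈ : ∀ x → distToCode C x ≡ 0 → C x ≡ true
    distToCode≡0⇒∈ x eq with distToCode-attained C x Cc₀
    ... | c , Cc , eq′ = subst (λ y → C y ≡ true) (sym (dist≡0⇒≡ x c (trans (sym eq′) eq))) Cc

  ∈⇒distToCode≡0 : ∀ {n} (C : Code n) x → C x ≡ true → distToCode C x ≡ 0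
  ∈⇒distToCode≡0 C x Cx = n≤0⇒n≡0 (subst (distToCode C x ≤_) (dist-self x) (distToCode≤dist C x x Cx))

  module _ {n : ℕ} (f : Word n → ℕ) where

    maximum : List (Word n) → ℕ
    maximum = foldr (λ x acc → f x ⊔ acc) 0

    ≤-maximum : ∀ ys {x} → x ∈ ys → f x ≤ maximum ys
    ≤-maximum (y ∷ ys) (here refl)  = m≤m⊔n _ _
    ≤-maximum (y ∷ ys) (there x∈ys) = ≤-trans (≤-maximum ys x∈ys) (m≤n⊔m _ _)

    maximum≤ : ∀ ys k → (∀ x → f x ≤ k) → maximum ys ≤ k
    maximum≤ []       k bound = z≤n
    maximum≤ (y ∷ ys) k bound = ⊔-lub (bound y) (maximum≤ ys k bound)

    maximum-sel : ∀ ys → maximum ys ≡ 0 ⊎ ∃ λ x → maximum ys ≡ f x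
    maximum-sel []       = inj₁ refl
    maximum-sel (y ∷ ys) with ⊔-sel (f y) (maximum ys)
    ... | inj₁ eq = inj₂ (y , eq)
    ... | inj₂ eq rewrite eq = maximum-sel ys

  distToCode≤coveringRadius : ∀ {n} (C : Code n) x → distToCode C x ≤ coveringRadius C
  distToCode≤coveringRadius {n} C x = ≤-maximum (distToCode C) (allWords n) (∈-allWords x)

  coveringRadius-attained : ∀ {n} (C : Code n) → 0 < coveringRadius C →
                            ∃ λ x → distToCode C x ≡ coveringRadius C
  coveringRadius-attained {n} C pos with maximum-sel (distToCode C) (allWords n)
  ... | inj₁ eq       = ⊥-elim (<⇒≢ pos (sym eq))
  ... | inj₂ (x , eq) = x , sym eq

  coveringRadius-maximum : ∀ {n} (C : Code n) k x → distToCode C x ≡ k →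
                           (∀ y → distToCode C y ≤ k) → coveringRadius C ≡ k
  coveringRadius-maximum {n} C k x refl bound =
    ≤-antisym (maximum≤ (distToCode C) (allWords n) k bound) (distToCode≤coveringRadius C x)

  bit : Bool → ℕ
  bit true  = 1
  bit false = 0

  length-filterᵇ-tabulate : ∀ {A : Set} {n} (q : A → Bool) (f : Fin n → A) →
                            length (filterᵇ q (tabulate f)) ≡ sum (λ i → bit (q (f i)))
  length-filterᵇ-tabulate {n = zero}  q f = refl
  length-filterᵇ-tabulate {n = suc n} q f with q (f fzero)
  ... | true  = cong suc (length-filterᵇ-tabulate q (λ i → f (fsuc i)))
  ... | false = length-filterᵇ-tabulate q (λ i → f (fsuc i))

  neighboursIn≡sum : ∀ {n} (C : Code n) x L →
                     neighboursIn C x L ≡ sum (λ i → bit (distToCode C (toggle x i) ≡ᵇ L))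
  neighboursIn≡sum C x L = length-filterᵇ-tabulate (λ i → distToCode C (toggle x i) ≡ᵇ L) (λ i → i)

  bit-≢ : ∀ {a b} → a ≢ b → bit (a ≡ᵇ b) ≡ 0
  bit-≢ {a} {b} a≢b with a ≡ᵇ b in eq
  ... | false = refl
  ... | true  = ⊥-elim (a≢b (≡ᵇ⇒≡ a b (subst T (sym eq) _)))

  sum-bits-positive : ∀ {n} (q : Fin n → Bool) → 0 < sum (λ i → bit (q i)) → ∃ λ i → q i ≡ true
  sum-bits-positive {suc n} q pos with q fzero in eq
  ... | true  = fzero , eq
  ... | false with sum-bits-positive (λ i → q (fsuc i)) pos
  ...   | i , eq′ = fsuc i , eq′

  sum-const-1 : ∀ n → sum {n} (λ _ → 1) ≡ n
  sum-const-1 zero    = refl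
  sum-const-1 (suc n) = cong suc (sum-const-1 n)

  ∑levels : (ℕ → ℕ) → ℕ
  ∑levels f = f 0 + (f 1 + (f 2 + f 3))

  ∑levels-cong : ∀ {f g} → (∀ k → f k ≡ g k) → ∑levels f ≡ ∑levels g
  ∑levels-cong f≗g = cong₂ _+_ (f≗g 0) (cong₂ _+_ (f≗g 1) (cong₂ _+_ (f≗g 2) (f≗g 3)))

  split-level : ∀ {v} → v ≤ 3 → (g : ℕ → ℕ) → g v ≡ ∑levels (λ k → g k * bit (v ≡ᵇ k))
  split-level {0} _ g = lemma (g 0) (g 1) (g 2) (g 3)
    where lemma : ∀ a b c d → a ≡ a * 1 + (b * 0 + (c * 0 + d * 0))
          lemma = solve-∀
  split-level {1} _ g = lemma (g 0) (g 1) (g 2) (g 3)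
    where lemma : ∀ a b c d → b ≡ a * 0 + (b * 1 + (c * 0 + d * 0))
          lemma = solve-∀
  split-level {2} _ g = lemma (g 0) (g 1) (g 2) (g 3)
    where lemma : ∀ a b c d → c ≡ a * 0 + (b * 0 + (c * 1 + d * 0))
          lemma = solve-∀
  split-level {3} _ g = lemma (g 0) (g 1) (g 2) (g 3)
    where lemma : ∀ a b c d → d ≡ a * 0 + (b * 0 + (c * 0 + d * 1))
          lemma = solve-∀
  split-level {suc (suc (suc (suc _)))} (s≤s (s≤s (s≤s ()))) g

  sum-∑levels : ∀ {n} (F : Fin n → ℕ → ℕ) → sum (λ i → ∑levels (F i)) ≡ ∑levels (λ k → sum (λ i → F i k))
  sum-∑levels F = trans (∑-distrib-+ (λ i → F i 0) (λ i → F i 1 + (F i 2 + F i 3)))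
    (cong (sum (λ i → F i 0) +_) (trans (∑-distrib-+ (λ i → F i 1) (λ i → F i 2 + F i 3))
      (cong (sum (λ i → F i 1) +_) (∑-distrib-+ (λ i → F i 2) (λ i → F i 3)))))

  sum-by-level : ∀ {n} (f : Fin n → ℕ) → (∀ i → f i ≤ 3) → (g : ℕ → ℕ) →
                 sum (λ i → g (f i)) ≡ ∑levels (λ k → g k * sum (λ i → bit (f i ≡ᵇ k)))
  sum-by-level f f≤3 g = begin
    sum (λ i → g (f i))
      ≡⟨ sum-cong-≗ (λ i → split-level (f≤3 i) g) ⟩
    sum (λ i → ∑levels (λ k → g k * bit (f i ≡ᵇ k)))
      ≡⟨ sum-∑levels (λ i k → g k * bit (f i ≡ᵇ k)) ⟩
    ∑levels (λ k → sum (λ i → g k * bit (f i ≡ᵇ k)))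
      ≡⟨ ∑levels-cong (λ k → sym (*-distribˡ-sum (g k) (λ i → bit (f i ≡ᵇ k)))) ⟩
    ∑levels (λ k → g k * sum (λ i → bit (f i ≡ᵇ k))) ∎
    where open ≡-Reasoning


module CompletelyRegular {n : ℕ} (C : Code n) (0∈C : C (zeroWord n) ≡ true) (ρ≡3 : coveringRadius C ≡ 3)
  (b₁ c₂ : ℕ) (cr : IsCompletelyRegularWithArray C (n ∷ b₁ ∷ 1 ∷ []) (1 ∷ c₂ ∷ n ∷ [])) where

  open import Data.Bool using (true; T)
  open import Data.Nat using (ℕ; suc; _+_; _*_; _∸_; _≡ᵇ_; _≤_; _<_; z≤n; s≤s)
  open import Data.Nat.Properties
  open import Data.List using ([]; _∷_)
  open import Data.Product using (_,_; ∃; proj₁; proj₂)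
  open import Data.Empty using (⊥)
  open import Relation.Binary.PropositionalEquality
  open import Data.Nat.Tactic.RingSolver using (solve-∀)
  open import Algebra.Properties.Semiring.Sum +-*-semiring using (sum; sum-cong-≗; sum-replicate-zero)
  open Words
  open Levels

  level : Word n → ℕ
  level = distToCode C

  N : ℕ → Word n → ℕ
  N L y = neighboursIn C y L

  a₁ a₂ : ℕ
  a₁ = n ∸ suc b₁
  a₂ = n ∸ suc c₂

  quotient : ℕ → ℕ → ℕ
  quotient 0 1 = n
  quotient 1 0 = 1
  quotient 1 1 = a₁
  quotient 1 2 = b₁
  quotient 2 1 = c₂
  quotient 2 2 = a₂
  quotient 2 3 = 1
  quotient 3 2 = n
  quotient _ _ = 0

  level≤3 : ∀ y → level y ≤ 3
  level≤3 y = subst (level y ≤_) ρ≡3 (distToCode≤coveringRadius C y)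

  neighbours-total : ∀ y → ∑levels (λ L → N L y) ≡ n
  neighbours-total y = begin
    ∑levels (λ L → N L y)
      ≡⟨ ∑levels-cong (λ L → trans (neighboursIn≡sum C y L) (sym (*-identityˡ _))) ⟩
    ∑levels (λ L → 1 * sum (λ i → bit (level (toggle y i) ≡ᵇ L)))
      ≡⟨ sum-by-level (λ i → level (toggle y i)) (λ i → level≤3 (toggle y i)) (λ _ → 1) ⟨
    sum {n} (λ i → 1)
      ≡⟨ sum-const-1 n ⟩
    n ∎
    where open ≡-Reasoning

  neighbours-absent : ∀ y L → (∀ i → level (toggle y i) ≢ L) → N L y ≡ 0
  neighbours-absent y L absent =
    trans (neighboursIn≡sum C y L) (trans (sum-cong-≗ (λ i → bit-≢ (absent i))) (sum-replicate-zero n))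

  neighbours-far : ∀ y {k} L → level y ≡ k → (L ≤ suc k → k ≤ suc L → ⊥) → N L y ≡ 0
  neighbours-far y L refl far = neighbours-absent y L λ i eq →
    far (subst (_≤ suc (level y)) eq (distToCode-toggle≤ C 0∈C y i))
        (subst (λ l → level y ≤ suc l) eq (distToCode≤toggle C 0∈C y i))

  neighbours-up : ∀ y l → level y ≡ l → l < 3 → N (suc l) y ≡ at (n ∷ b₁ ∷ 1 ∷ []) l
  neighbours-up y l eq l<3 = proj₁ (proj₂ (proj₂ cr) y l eq) (subst (l <_) (sym ρ≡3) l<3)

  neighbours-down : ∀ y k → level y ≡ suc k → N k y ≡ at (1 ∷ c₂ ∷ n ∷ []) k
  neighbours-down y k eq = proj₂ (proj₂ (proj₂ cr) y (suc k) eq) k refl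

  neighbour-at : ∀ y L → 0 < N L y → ∃ λ i → level (toggle y i) ≡ L
  neighbour-at y L pos with sum-bits-positive _ (subst (0 <_) (neighboursIn≡sum C y L) pos)
  ... | i , eq = i , ≡ᵇ⇒≡ _ L (subst T (sym eq) _)

  private
    counts-sum : ∀ y {p q r s} → N 0 y ≡ p → N 1 y ≡ q → N 2 y ≡ r → N 3 y ≡ s → p + (q + (r + s)) ≡ n
    counts-sum y refl refl refl refl = neighbours-total y

    ≡∸ : ∀ {a x m} → a + x ≡ m → x ≡ m ∸ a
    ≡∸ {a} {x} eq = trans (sym (m+n∸m≡n a x)) (cong (_∸ a) eq)

    at-level-0 : ∀ y L → level y ≡ 0 → N L y ≡ quotient 0 L
    at-level-0 y 0 eq =
      trans (≡∸ (trans (+-comm n _) (trans (cong (N 0 y +_) (sym (+-identityʳ n))) total))) (n∸n≡0 n)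
      where total = counts-sum y refl (neighbours-up y 0 eq (s≤s z≤n))
                      (neighbours-far y 2 eq λ { (s≤s ()) _ }) (neighbours-far y 3 eq λ { (s≤s ()) _ })
    at-level-0 y 1 eq = neighbours-up y 0 eq (s≤s z≤n)
    at-level-0 y (suc (suc L)) eq = neighbours-far y (suc (suc L)) eq λ { (s≤s ()) _ }

    at-level-1 : ∀ y L → level y ≡ 1 → N L y ≡ quotient 1 L
    at-level-1 y 0 eq = neighbours-down y 0 eq
    at-level-1 y 1 eq = ≡∸ (trans (shuffle (N 1 y) b₁) total)
      where
      shuffle : ∀ x b → suc b + x ≡ 1 + (x + (b + 0))
      shuffle = solve-∀
      total = counts-sum y (neighbours-down y 0 eq) refl (neighbours-up y 1 eq (s≤s (s≤s z≤n)))
                (neighbours-far y 3 eq λ { (s≤s (s≤s ())) _ })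
    at-level-1 y 2 eq = neighbours-up y 1 eq (s≤s (s≤s z≤n))
    at-level-1 y (suc (suc (suc L))) eq = neighbours-far y (suc (suc (suc L))) eq λ { (s≤s (s≤s ())) _ }

    at-level-2 : ∀ y L → level y ≡ 2 → N L y ≡ quotient 2 L
    at-level-2 y 0 eq = neighbours-far y 0 eq λ _ → λ { (s≤s ()) }
    at-level-2 y 1 eq = neighbours-down y 1 eq
    at-level-2 y 2 eq = ≡∸ (trans (shuffle (N 2 y) c₂) total)
      where
      shuffle : ∀ x c → suc c + x ≡ c + (x + 1)
      shuffle = solve-∀
      total = counts-sum y (neighbours-far y 0 eq λ _ → λ { (s≤s ()) }) (neighbours-down y 1 eq) refl
                (neighbours-up y 2 eq (s≤s (s≤s (s≤s z≤n))))
    at-level-2 y 3 eq = neighbours-up y 2 eq (s≤s (s≤s (s≤s z≤n)))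
    at-level-2 y (suc (suc (suc (suc L)))) eq =
      neighbours-far y (suc (suc (suc (suc L)))) eq λ { (s≤s (s≤s (s≤s ()))) _ }

    at-level-3 : ∀ y L → level y ≡ 3 → N L y ≡ quotient 3 L
    at-level-3 y 0 eq = neighbours-far y 0 eq λ _ → λ { (s≤s ()) }
    at-level-3 y 1 eq = neighbours-far y 1 eq λ _ → λ { (s≤s (s≤s ())) }
    at-level-3 y 2 eq = neighbours-down y 2 eq
    at-level-3 y 3 eq = trans (≡∸ total) (n∸n≡0 n)
      where total = counts-sum y (neighbours-far y 0 eq λ _ → λ { (s≤s ()) })
                      (neighbours-far y 1 eq λ _ → λ { (s≤s (s≤s ())) }) (neighbours-down y 2 eq) refl
    at-level-3 y (suc (suc (suc (suc L)))) eq = neighbours-absent y _ λ i eq′ →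
      <⇒≱ (s≤s (s≤s (s≤s (s≤s z≤n)))) (subst (_≤ 3) eq′ (level≤3 (toggle y i)))

  neighbours≡quotient : ∀ y L → N L y ≡ quotient (level y) L
  neighbours≡quotient y L with level y in eq | level≤3 y
  ... | 0 | _ = at-level-0 y L eq
  ... | 1 | _ = at-level-1 y L eq
  ... | 2 | _ = at-level-2 y L eq
  ... | 3 | _ = at-level-3 y L eq
  ... | suc (suc (suc (suc _))) | s≤s (s≤s (s≤s ()))

  valency : ∀ y → ∑levels (quotient (level y)) ≡ n
  valency y = trans (∑levels-cong (λ L → sym (neighbours≡quotient y L))) (neighbours-total y)

  level-word : ∀ y L → 0 < quotient (level y) L → ∃ λ z → level z ≡ L
  level-word y L pos with neighbour-at y L (subst (0 <_) (sym (neighbours≡quotient y L)) pos)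
  ... | i , eq = toggle y i , eq

  level-3-word : ∃ λ x → level x ≡ 3
  level-3-word with coveringRadius-attained C (subst (0 <_) (sym ρ≡3) (s≤s z≤n))
  ... | x , eq = x , trans eq ρ≡3

  3≤n : 3 ≤ n
  3≤n with level-3-word
  ... | x , eq = subst (_≤ n) eq (≤-trans (distToCode≤dist C x (zeroWord n) 0∈C) (weight≤length (x ⊕ zeroWord n)))

  0<n : 0 < n
  0<n = ≤-trans (s≤s z≤n) 3≤n

  level-2-word : ∃ λ x → level x ≡ 2
  level-2-word with level-3-word
  ... | x , eq = level-word x 2 (subst (λ k → 0 < quotient k 2) (sym eq) 0<n)

  level-1-word : ∃ λ x → level x ≡ 1
  level-1-word =
    level-word (zeroWord n) 1 (subst (λ k → 0 < quotient k 1) (sym (∈⇒distToCode≡0 C _ 0∈C)) 0<n)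

  c₁+a₁+b₁≡n : 1 + (a₁ + (b₁ + 0)) ≡ n
  c₁+a₁+b₁≡n with level-1-word
  ... | x , eq = subst (λ k → ∑levels (quotient k) ≡ n) eq (valency x)

  c₂+a₂+b₂≡n : c₂ + (a₂ + 1) ≡ n
  c₂+a₂+b₂≡n with level-2-word
  ... | x , eq = subst (λ k → ∑levels (quotient k) ≡ n) eq (valency x)

module Extension where

  open import Data.Bool using (Bool; true; false; not; _∧_; _xor_)
  open import Data.Bool.Properties
    using (xor-assoc; xor-same; not-distribˡ-xor; not-distribʳ-xor; xor-∧-commutativeRing)
  open import Data.Nat using (ℕ; zero; suc; _+_; _≡ᵇ_; _≤_; z≤n; s≤s)
  open import Data.Nat.Properties
  open import Data.Fin using (inject₁; fromℕ) renaming (zero to fzero; suc to fsuc)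
  open import Data.Vec using (Vec; []; _∷_; _∷ʳ_; init; last; initLast)
  open import Data.Vec.Properties using (init-∷ʳ; last-∷ʳ)
  open import Data.Product using (_×_; _,_; proj₂)
  open import Data.Sum using (inj₁; inj₂)
  open import Relation.Binary.PropositionalEquality
  open import Algebra.Bundles using (CommutativeRing)
  open import Algebra.Properties.CommutativeSemigroup
    (CommutativeRing.+-commutativeSemigroup xor-∧-commutativeRing) using (interchange)
  open import Algebra.Properties.Semiring.Sum +-*-semiring using (sum; sum-cong-≗; sum-init-last)
  open Words
  open Levels

  odd : ℕ → Bool
  odd zero    = false
  odd (suc k) = not (odd k)

  parity≡odd-weight : ∀ {n} (x : Word n) → parity x ≡ odd (weight x)
  parity≡odd-weight []          = refl
  parity≡odd-weight (false ∷ x) = parity≡odd-weight x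
  parity≡odd-weight (true  ∷ x) = cong not (parity≡odd-weight x)

  parity-⊕ : ∀ {n} (x y : Word n) → parity (x ⊕ y) ≡ parity x xor parity y
  parity-⊕ []      []      = refl
  parity-⊕ (a ∷ x) (b ∷ y) = trans (cong ((a xor b) xor_) (parity-⊕ x y)) (interchange a b (parity x) (parity y))

  odd-dist : ∀ {n} (x y : Word n) → odd (dist x y) ≡ parity x xor parity y
  odd-dist x y = trans (sym (parity≡odd-weight (x ⊕ y))) (parity-⊕ x y)

  parity-toggle : ∀ {n} (x : Word n) i → parity (toggle x i) ≡ not (parity x)
  parity-toggle (a ∷ x) fzero    = sym (not-distribˡ-xor a (parity x))
  parity-toggle (a ∷ x) (fsuc i) = trans (cong (a xor_) (parity-toggle x i)) (sym (not-distribʳ-xor a (parity x)))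

  dist-∷ʳ : ∀ {n} (x y : Word n) p q → dist (x ∷ʳ p) (y ∷ʳ q) ≡ dist x y + bit (p xor q)
  dist-∷ʳ []          []          false false = refl
  dist-∷ʳ []          []          false true  = refl
  dist-∷ʳ []          []          true  false = refl
  dist-∷ʳ []          []          true  true  = refl
  dist-∷ʳ (false ∷ x) (false ∷ y) p q = dist-∷ʳ x y p q
  dist-∷ʳ (true  ∷ x) (true  ∷ y) p q = dist-∷ʳ x y p q
  dist-∷ʳ (false ∷ x) (true  ∷ y) p q = cong suc (dist-∷ʳ x y p q)
  dist-∷ʳ (true  ∷ x) (false ∷ y) p q = cong suc (dist-∷ʳ x y p q)

  toggle-∷ʳ-inject₁ : ∀ {n} (x : Word n) p i → toggle (x ∷ʳ p) (inject₁ i) ≡ toggle x i ∷ʳ p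
  toggle-∷ʳ-inject₁ (a ∷ x) p fzero    = refl
  toggle-∷ʳ-inject₁ (a ∷ x) p (fsuc i) = cong (a ∷_) (toggle-∷ʳ-inject₁ x p i)

  toggle-∷ʳ-fromℕ : ∀ {n} (x : Word n) p → toggle (x ∷ʳ p) (fromℕ n) ≡ x ∷ʳ not p
  toggle-∷ʳ-fromℕ []      p = refl
  toggle-∷ʳ-fromℕ (a ∷ x) p = cong (a ∷_) (toggle-∷ʳ-fromℕ x p)

  ∷ʳ-init-last : ∀ {A : Set} {n} (z : Vec A (suc n)) → z ≡ init z ∷ʳ last z
  ∷ʳ-init-last z = proj₂ (proj₂ (initLast z))

  extendedCode-∷ʳ : ∀ {n} (C : Code n) y q → extendedCode C (y ∷ʳ q) ≡ C y ∧ not (q xor parity y)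
  extendedCode-∷ʳ C y q rewrite init-∷ʳ q y | last-∷ʳ q y = refl

  -- With k = d(x,C) and β = p xor parity x this is d(x ∷ʳ p, C*): a nearest c ∷ʳ parity c costs
  -- one more exactly when p ≠ parity c, i.e. when β ≠ odd (dist x c).
  extLevel : Bool → ℕ → ℕ
  extLevel β k = k + bit (β xor odd k)

  bit≤1 : ∀ b → bit b ≤ 1
  bit≤1 true  = s≤s z≤n
  bit≤1 false = z≤n

  extLevel-mono : ∀ β {l d} → l ≤ d → extLevel β l ≤ extLevel β d
  extLevel-mono β {l} {d} l≤d with m≤n⇒m<n∨m≡n l≤d
  ... | inj₂ refl = ≤-refl
  ... | inj₁ l<d  = ≤-trans (+-monoʳ-≤ l (bit≤1 (β xor odd l))) (≤-trans (subst (_≤ d) (+-comm 1 l) l<d) (m≤m+n d _))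

  dist-∷ʳ-parity : ∀ {n} (x y : Word n) p → dist (x ∷ʳ p) (y ∷ʳ parity y) ≡ extLevel (p xor parity x) (dist x y)
  dist-∷ʳ-parity x y p = trans (dist-∷ʳ x y p (parity y)) (cong (λ b → dist x y + bit b) (sym shift))
    where
    shift : (p xor parity x) xor odd (dist x y) ≡ p xor parity y
    shift = begin
      (p xor parity x) xor odd (dist x y)            ≡⟨ cong ((p xor parity x) xor_) (odd-dist x y) ⟩
      (p xor parity x) xor (parity x xor parity y)   ≡⟨ xor-assoc p (parity x) _ ⟩
      p xor (parity x xor (parity x xor parity y))   ≡⟨ cong (p xor_) (sym (xor-assoc (parity x) (parity x) _)) ⟩
      p xor ((parity x xor parity x) xor parity y)   ≡⟨ cong (λ b → p xor (b xor parity y)) (xor-same (parity x)) ⟩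
      p xor parity y                                 ∎
      where open ≡-Reasoning

  extended-codeword : ∀ {n} (C : Code n) z → extendedCode C z ≡ true →
                      C (init z) ≡ true × last z ≡ parity (init z)
  extended-codeword C z eq with C (init z) | last z | parity (init z)
  ... | true | false | false = refl , refl
  ... | true | true  | true  = refl , refl

  module _ {n : ℕ} (C : Code n) {c₀ : Word n} (Cc₀ : C c₀ ≡ true) where

    distToCode-extended : ∀ x p → distToCode (extendedCode C) (x ∷ʳ p) ≡ extLevel (p xor parity x) (distToCode C x)
    distToCode-extended x p with distToCode-attained C x Cc₀
    ... | c , Cc , eq rewrite eq =
      distToCode-minimum (extendedCode C) (x ∷ʳ p) _ c*∈C* (dist-∷ʳ-parity x c p) lower
      where
      c*∈C* : extendedCode C (c ∷ʳ parity c) ≡ true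
      c*∈C* = trans (extendedCode-∷ʳ C c (parity c)) (cong₂ (λ a b → a ∧ not b) Cc (xor-same (parity c)))
      lower : ∀ z → extendedCode C z ≡ true → extLevel (p xor parity x) (dist x c) ≤ dist (x ∷ʳ p) z
      lower z z∈C* with extended-codeword C z z∈C*
      ... | y∈C , last≡parity =
        subst (λ w → extLevel (p xor parity x) (dist x c) ≤ dist (x ∷ʳ p) w)
              (trans (cong (init z ∷ʳ_) (sym last≡parity)) (sym (∷ʳ-init-last z)))
              (subst (extLevel (p xor parity x) (dist x c) ≤_) (sym (dist-∷ʳ-parity x (init z) p))
                     (extLevel-mono (p xor parity x)
                       (subst (_≤ dist x (init z)) eq (distToCode≤dist C x (init z) y∈C))))

    neighboursIn-extended : ∀ x p L →
      neighboursIn (extendedCode C) (x ∷ʳ p) L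
        ≡ sum (λ i → bit (extLevel (not (p xor parity x)) (distToCode C (toggle x i)) ≡ᵇ L))
          + bit (extLevel (not (p xor parity x)) (distToCode C x) ≡ᵇ L)
    neighboursIn-extended x p L =
      trans (neighboursIn≡sum (extendedCode C) (x ∷ʳ p) L)
            (trans (sum-init-last (λ j → bit (distToCode (extendedCode C) (toggle (x ∷ʳ p) j) ≡ᵇ L)))
                   (cong₂ _+_ (sum-cong-≗ inner) outer))
      where
      inner : ∀ i → bit (distToCode (extendedCode C) (toggle (x ∷ʳ p) (inject₁ i)) ≡ᵇ L)
                  ≡ bit (extLevel (not (p xor parity x)) (distToCode C (toggle x i)) ≡ᵇ L)
      inner i rewrite toggle-∷ʳ-inject₁ x p i | distToCode-extended (toggle x i) p
                    | parity-toggle x i | not-distribʳ-xor p (parity x) = refl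
      outer : bit (distToCode (extendedCode C) (toggle (x ∷ʳ p) (fromℕ n)) ≡ᵇ L)
            ≡ bit (extLevel (not (p xor parity x)) (distToCode C x) ≡ᵇ L)
      outer rewrite toggle-∷ʳ-fromℕ x p | distToCode-extended x (not p) | not-distribˡ-xor p (parity x) = refl

module ExtendedCompletelyRegular {n : ℕ} (C : Code n) (0∈C : C (zeroWord n) ≡ true) (ρ≡3 : coveringRadius C ≡ 3)
  (b₁ c₂ : ℕ) (cr : IsCompletelyRegularWithArray C (n ∷ b₁ ∷ 1 ∷ []) (1 ∷ c₂ ∷ n ∷ [])) where

  open import Data.Bool using (Bool; true; false; not; _xor_)
  open import Data.Bool.Properties using (xor-same)
  open import Data.Nat using (ℕ; suc; _+_; _*_; _≡ᵇ_; _≤_; _<_; z≤n; s≤s)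
  open import Data.Nat.Properties
  open import Data.Nat.Tactic.RingSolver using (solve-∀)
  open import Data.List using (List; []; _∷_)
  open import Data.Vec using (_∷ʳ_; init; last)
  open import Data.Product using (_×_; _,_; proj₁)
  open import Relation.Binary.PropositionalEquality
  open import Algebra.Properties.Semiring.Sum +-*-semiring using (sum)
  open Words
  open Levels
  open Extension
  open CompletelyRegular C 0∈C ρ≡3 b₁ c₂ cr

  bs* cs* : List ℕ
  bs* = suc n ∷ n ∷ b₁ ∷ 1 ∷ []
  cs* = 1 ∷ c₂ ∷ n ∷ suc n ∷ []

  -- Toggling any coordinate of x ∷ʳ p flips p xor parity x, hence the `not β`.
  extQuotient : Bool → ℕ → ℕ → ℕ
  extQuotient β k L = ∑levels (λ j → bit (extLevel (not β) j ≡ᵇ L) * quotient k j) + bit (extLevel (not β) k ≡ᵇ L)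

  ArrayAt : ℕ → (ℕ → ℕ) → Set
  ArrayAt l count = (l < 4 → count (suc l) ≡ at bs* l) × (∀ j → l ≡ suc j → count j ≡ at cs* j)

  -- The entries of extQuotient reduce to sums in which every `1 * x` has become `x + 0`.
  private
    x+0+0+0≡x : ∀ x → x + 0 + 0 + 0 ≡ x
    x+0+0+0≡x = solve-∀

    x+0+0+1≡1+x : ∀ x → x + 0 + 0 + 1 ≡ suc x
    x+0+0+1≡1+x = solve-∀

    b₁+a₁+2≡n+1 : b₁ + suc (a₁ + 0 + 0 + 1) ≡ n + 1
    b₁+a₁+2≡n+1 = trans (shuffle a₁ b₁) (cong (_+ 1) c₁+a₁+b₁≡n)
      where shuffle : ∀ a b → b + suc (a + 0 + 0 + 1) ≡ 1 + (a + (b + 0)) + 1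
            shuffle = solve-∀

    a₂+2+c₂≡n+1 : a₂ + 0 + 1 + 1 + c₂ ≡ n + 1
    a₂+2+c₂≡n+1 = trans (shuffle a₂ c₂) (cong (_+ 1) c₂+a₂+b₂≡n)
      where shuffle : ∀ a c → a + 0 + 1 + 1 + c ≡ c + (a + 1) + 1
            shuffle = solve-∀

  module _ (b₁+c₂≡n+1 : b₁ + c₂ ≡ n + 1) where

    extended-array : ∀ β k → k ≤ 3 → ArrayAt (extLevel β k) (extQuotient β k)
    extended-array false 0 _ = (λ _ → x+0+0+1≡1+x n) , λ _ ()
    extended-array true  0 _ = (λ _ → x+0+0+0≡x n) , λ { 0 refl → refl }
    extended-array false 1 _ =
      (λ _ → x+0+0+0≡x b₁) , λ { 1 refl → +-cancelˡ-≡ b₁ _ _ (trans b₁+a₁+2≡n+1 (sym b₁+c₂≡n+1)) }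
    extended-array true  1 _ = (λ _ → trans (shuffle a₁ b₁) c₁+a₁+b₁≡n) , λ { 0 refl → refl }
      where shuffle : ∀ a b → a + 0 + (b + 0 + 0) + 1 ≡ 1 + (a + (b + 0))
            shuffle = solve-∀
    extended-array false 2 _ =
      (λ _ → +-cancelʳ-≡ c₂ _ _ (trans a₂+2+c₂≡n+1 (sym b₁+c₂≡n+1))) , λ { 1 refl → x+0+0+0≡x c₂ }
    extended-array true  2 _ = (λ _ → refl) , λ { 2 refl → trans (shuffle a₂ c₂) c₂+a₂+b₂≡n }
      where shuffle : ∀ a c → c + 0 + (a + 0 + 0) + 1 ≡ c + (a + 1)
            shuffle = solve-∀
    extended-array false 3 _ = (λ { (s≤s (s≤s (s≤s (s≤s ())))) }) , λ { 3 refl → x+0+0+1≡1+x n }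
    extended-array true  3 _ = (λ _ → refl) , λ { 2 refl → x+0+0+0≡x n }
    extended-array _ (suc (suc (suc (suc _)))) (s≤s (s≤s (s≤s ())))

  level* : Word (suc n) → ℕ
  level* = distToCode (extendedCode C)

  level*-∷ʳ : ∀ x p → level* (x ∷ʳ p) ≡ extLevel (p xor parity x) (level x)
  level*-∷ʳ = distToCode-extended C 0∈C

  neighbours*≡extQuotient : ∀ x p L →
    neighboursIn (extendedCode C) (x ∷ʳ p) L ≡ extQuotient (p xor parity x) (level x) L
  neighbours*≡extQuotient x p L = begin
    neighboursIn (extendedCode C) (x ∷ʳ p) L
      ≡⟨ neighboursIn-extended C 0∈C x p L ⟩
    sum (λ i → g (level (toggle x i))) + g (level x)
      ≡⟨ cong (_+ g (level x)) (sum-by-level (λ i → level (toggle x i)) (λ i → level≤3 (toggle x i)) g) ⟩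
    ∑levels (λ k → g k * sum (λ i → bit (level (toggle x i) ≡ᵇ k))) + g (level x)
      ≡⟨ cong (_+ g (level x)) (∑levels-cong λ k →
           cong (g k *_) (trans (sym (neighboursIn≡sum C x k)) (neighbours≡quotient x k))) ⟩
    extQuotient (p xor parity x) (level x) L ∎
    where
    open ≡-Reasoning
    g : ℕ → ℕ
    g k = bit (extLevel (not (p xor parity x)) k ≡ᵇ L)

  coveringRadius-extended : coveringRadius (extendedCode C) ≡ 4
  coveringRadius-extended with level-3-word
  ... | x , eq = coveringRadius-maximum (extendedCode C) 4 (x ∷ʳ parity x) level≡4 level*≤4
    where
    level≡4 : level* (x ∷ʳ parity x) ≡ 4
    level≡4 = trans (level*-∷ʳ x (parity x)) (cong₂ extLevel (xor-same (parity x)) eq)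
    level*≤4 : ∀ z → level* z ≤ 4
    level*≤4 z = subst (λ w → level* w ≤ 4) (sym (∷ʳ-init-last z))
      (subst (_≤ 4) (sym (level*-∷ʳ (init z) (last z))) (+-mono-≤ (level≤3 (init z)) (bit≤1 _)))

  extended-completelyRegular : b₁ + c₂ ≡ n + 1 → IsCompletelyRegularWithArray (extendedCode C) bs* cs*
  extended-completelyRegular b₁+c₂≡n+1 =
    sym coveringRadius-extended , sym coveringRadius-extended , λ z l eq →
      subst (λ w → level* w ≡ l → Array w l) (sym (∷ʳ-init-last z)) (array-∷ʳ (init z) (last z) l) eq
    where
    Array : Word (suc n) → ℕ → Set
    Array z l = (l < coveringRadius (extendedCode C) → neighboursIn (extendedCode C) z (suc l) ≡ at bs* l)
              × (∀ j → l ≡ suc j → neighboursIn (extendedCode C) z j ≡ at cs* j)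
    array-∷ʳ : ∀ x p l → level* (x ∷ʳ p) ≡ l → Array (x ∷ʳ p) l
    array-∷ʳ x p l eq with extended-array b₁+c₂≡n+1 (p xor parity x) (level x) (level≤3 x)
    ... | up , down rewrite sym (trans (sym (level*-∷ʳ x p)) eq) =
      (λ l<ρ → trans (neighbours*≡extQuotient x p _)
                     (up (subst (extLevel (p xor parity x) (level x) <_) coveringRadius-extended l<ρ))) ,
      (λ j eq′ → trans (neighbours*≡extQuotient x p j) (down j eq′))

  extended-completelyRegular⇒ : IsCompletelyRegularWithArray (extendedCode C) bs* cs* → b₁ + c₂ ≡ n + 1
  extended-completelyRegular⇒ (_ , _ , array) with level-2-word
  ... | x , eq = trans (cong (_+ c₂) (sym a₂+2≡b₁)) a₂+2+c₂≡n+1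
    where
    level*≡2 : level* (x ∷ʳ parity x) ≡ 2
    level*≡2 = trans (level*-∷ʳ x (parity x)) (cong₂ extLevel (xor-same (parity x)) eq)
    a₂+2≡b₁ : a₂ + 0 + 1 + 1 ≡ b₁
    a₂+2≡b₁ = begin
      a₂ + 0 + 1 + 1
        ≡⟨⟩
      extQuotient false 2 3
        ≡⟨ cong₂ (λ β k → extQuotient β k 3) (xor-same (parity x)) eq ⟨
      extQuotient (parity x xor parity x) (level x) 3
        ≡⟨ neighbours*≡extQuotient x (parity x) 3 ⟨
      neighboursIn (extendedCode C) (x ∷ʳ parity x) 3
        ≡⟨ proj₁ (array (x ∷ʳ parity x) 2 level*≡2)
                 (subst (2 <_) (sym coveringRadius-extended) (s≤s (s≤s (s≤s z≤n)))) ⟩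
      b₁ ∎
      where open ≡-Reasoning

module Characters where

  open import Data.Bool using (Bool; true; false; not; _∧_; _xor_)
  open import Data.Nat as ℕ using (ℕ; zero; suc)
  import Data.Nat.Properties as ℕₚ
  open import Data.Integer using (ℤ; +_; -_; _+_; _*_; _-_; _≤_; 0ℤ; 1ℤ)
  open import Data.Integer.Properties
  open import Data.Integer.Tactic.RingSolver using (solve-∀)
  open import Data.Fin using (Fin) renaming (zero to fzero; suc to fsuc)
  open import Data.Vec using ([]; _∷_)
  open import Function using (_∘_)
  open import Relation.Binary.PropositionalEquality
  open import Algebra.Properties.Semiring.Sum +-*-semiring using (sum; sum-cong-≗; *-distribˡ-sum)
  open Words

  sign : Bool → ℤ
  sign false = 1ℤ
  sign true  = - 1ℤ

  sign-xor : ∀ a b → sign (a xor b) ≡ sign a * sign b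
  sign-xor false false = refl
  sign-xor false true  = refl
  sign-xor true  false = refl
  sign-xor true  true  = refl

  sign-not-∧ : ∀ a b → sign (not a ∧ b) ≡ sign b * sign (a ∧ b)
  sign-not-∧ false false = refl
  sign-not-∧ false true  = refl
  sign-not-∧ true  false = refl
  sign-not-∧ true  true  = refl

  χ : ∀ {n} → Word n → Word n → ℤ
  χ u x = sign (dot x u)

  θ : ∀ {n} → Word n → ℤ
  θ []      = 0ℤ
  θ (b ∷ u) = sign b + θ u

  θ≡n-2weight : ∀ {n} (u : Word n) → θ u ≡ + n - + weight u - + weight u
  θ≡n-2weight []          = refl
  θ≡n-2weight {suc n} (false ∷ u) = trans (cong (λ t → 1ℤ + t) (θ≡n-2weight u)) (shift (+ n) (+ weight u))
    where shift : ∀ m w → 1ℤ + (m - w - w) ≡ (1ℤ + m) - w - w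
          shift = solve-∀
  θ≡n-2weight {suc n} (true ∷ u) = trans (cong (λ t → - 1ℤ + t) (θ≡n-2weight u)) (shift (+ n) (+ weight u))
    where shift : ∀ m w → - 1ℤ + (m - w - w) ≡ (1ℤ + m) - (1ℤ + w) - (1ℤ + w)
          shift = solve-∀

  θ≢length : ∀ {n} (u : Word n) → 0 ℕ.< weight u → θ u ≢ + n
  θ≢length {n} u w>0 θ≡n = ℕₚ.<⇒≢ w>0 (sym (ℕₚ.m+n≡0⇒m≡0 _ (+-injective 2w≡0)))
    where
    shift : ∀ N w → w + w ≡ N - (N - w - w)
    shift = solve-∀
    2w≡0 : + weight u + + weight u ≡ 0ℤ
    2w≡0 = trans (shift (+ n) (+ weight u))
                 (trans (cong (λ t → + n - t) (trans (sym (θ≡n-2weight u)) θ≡n)) (+-inverseʳ (+ n)))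

  ∑-χ-toggle : ∀ {n} (u x : Word n) → sum (λ i → χ u (toggle x i)) ≡ θ u * χ u x
  ∑-χ-toggle []      []      = refl
  ∑-χ-toggle (b ∷ u) (a ∷ x) = begin
    sign ((not a ∧ b) xor dot x u) + sum (λ i → sign ((a ∧ b) xor dot (toggle x i) u))
      ≡⟨ cong₂ _+_ (sign-xor (not a ∧ b) (dot x u)) (sum-cong-≗ (λ i → sign-xor (a ∧ b) (dot (toggle x i) u))) ⟩
    sign (not a ∧ b) * χ u x + sum (λ i → sign (a ∧ b) * χ u (toggle x i))
      ≡⟨ cong₂ (λ s t → s * χ u x + t) (sign-not-∧ a b)
               (trans (sym (*-distribˡ-sum (sign (a ∧ b)) (λ i → χ u (toggle x i))))
                      (cong (sign (a ∧ b) *_) (∑-χ-toggle u x))) ⟩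
    sign b * sign (a ∧ b) * χ u x + sign (a ∧ b) * (θ u * χ u x)
      ≡⟨ regroup (sign b) (sign (a ∧ b)) (θ u) (χ u x) ⟩
    (sign b + θ u) * (sign (a ∧ b) * χ u x)
      ≡⟨ cong ((sign b + θ u) *_) (sym (sign-xor (a ∧ b) (dot x u))) ⟩
    (sign b + θ u) * sign ((a ∧ b) xor dot x u) ∎
    where
    open ≡-Reasoning
    regroup : ∀ s t l c → s * t * c + t * (l * c) ≡ (s + l) * (t * c)
    regroup = solve-∀

  ∑ʷ : ∀ {n} → (Word n → ℤ) → ℤ
  ∑ʷ {zero}  f = f []
  ∑ʷ {suc n} f = ∑ʷ (f ∘ (false ∷_)) + ∑ʷ (f ∘ (true ∷_))

  ∑ʷ-cong : ∀ {n} {f g : Word n → ℤ} → (∀ x → f x ≡ g x) → ∑ʷ f ≡ ∑ʷ g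
  ∑ʷ-cong {zero}  f≗g = f≗g []
  ∑ʷ-cong {suc n} f≗g = cong₂ _+_ (∑ʷ-cong (f≗g ∘ (false ∷_))) (∑ʷ-cong (f≗g ∘ (true ∷_)))

  ∑ʷ-distrib-+ : ∀ {n} (f g : Word n → ℤ) → ∑ʷ (λ x → f x + g x) ≡ ∑ʷ f + ∑ʷ g
  ∑ʷ-distrib-+ {zero}  f g = refl
  ∑ʷ-distrib-+ {suc n} f g =
    trans (cong₂ _+_ (∑ʷ-distrib-+ (f ∘ (false ∷_)) (g ∘ (false ∷_))) (∑ʷ-distrib-+ (f ∘ (true ∷_)) (g ∘ (true ∷_))))
          (interchange (∑ʷ (f ∘ (false ∷_))) (∑ʷ (g ∘ (false ∷_))) (∑ʷ (f ∘ (true ∷_))) (∑ʷ (g ∘ (true ∷_))))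
    where interchange : ∀ a b c d → (a + b) + (c + d) ≡ (a + c) + (b + d)
          interchange = solve-∀

  *-distribˡ-∑ʷ : ∀ {n} c (f : Word n → ℤ) → c * ∑ʷ f ≡ ∑ʷ (λ x → c * f x)
  *-distribˡ-∑ʷ {zero}  c f = refl
  *-distribˡ-∑ʷ {suc n} c f =
    trans (*-distribˡ-+ c _ _) (cong₂ _+_ (*-distribˡ-∑ʷ c (f ∘ (false ∷_))) (*-distribˡ-∑ʷ c (f ∘ (true ∷_))))

  ∑ʷ-toggle : ∀ {n} (f : Word n → ℤ) i → ∑ʷ (λ x → f (toggle x i)) ≡ ∑ʷ f
  ∑ʷ-toggle {suc n} f fzero    = +-comm (∑ʷ (f ∘ (true ∷_))) (∑ʷ (f ∘ (false ∷_)))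
  ∑ʷ-toggle {suc n} f (fsuc i) = cong₂ _+_ (∑ʷ-toggle (f ∘ (false ∷_)) i) (∑ʷ-toggle (f ∘ (true ∷_)) i)

  ∑ʷ-zero : ∀ n → ∑ʷ {n} (λ _ → 0ℤ) ≡ 0ℤ
  ∑ʷ-zero zero    = refl
  ∑ʷ-zero (suc n) = cong₂ _+_ (∑ʷ-zero n) (∑ʷ-zero n)

  ∑ʷ-sum-comm : ∀ {n m} (g : Word n → Fin m → ℤ) → ∑ʷ (λ x → sum (g x)) ≡ sum (λ i → ∑ʷ (λ x → g x i))
  ∑ʷ-sum-comm {n} {zero}  g = ∑ʷ-zero n
  ∑ʷ-sum-comm {n} {suc m} g =
    trans (∑ʷ-distrib-+ (λ x → g x fzero) (λ x → sum (λ i → g x (fsuc i))))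
          (cong (λ t → ∑ʷ (λ x → g x fzero) + t) (∑ʷ-sum-comm (λ x i → g x (fsuc i))))

  ∑ʷ-nonneg : ∀ {n} (f : Word n → ℤ) → (∀ x → 0ℤ ≤ f x) → 0ℤ ≤ ∑ʷ f
  ∑ʷ-nonneg {zero}  f f≥0 = f≥0 []
  ∑ʷ-nonneg {suc n} f f≥0 = +-mono-≤ (∑ʷ-nonneg _ (f≥0 ∘ (false ∷_))) (∑ʷ-nonneg _ (f≥0 ∘ (true ∷_)))

  ≤-+-nonneg : ∀ a {b} → 0ℤ ≤ b → a ≤ a + b
  ≤-+-nonneg a 0≤b = subst (_≤ a + _) (+-identityʳ a) (+-monoʳ-≤ a 0≤b)

  term≤∑ʷ : ∀ {n} (f : Word n → ℤ) → (∀ x → 0ℤ ≤ f x) → ∀ x → f x ≤ ∑ʷ f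
  term≤∑ʷ {zero}  f f≥0 [] = ≤-refl
  term≤∑ʷ {suc n} f f≥0 (false ∷ x) =
    ≤-trans (term≤∑ʷ _ (f≥0 ∘ (false ∷_)) x) (≤-+-nonneg _ (∑ʷ-nonneg _ (f≥0 ∘ (true ∷_))))
  term≤∑ʷ {suc n} f f≥0 (true ∷ x) =
    ≤-trans (term≤∑ʷ _ (f≥0 ∘ (true ∷_)) x)
            (subst (∑ʷ (f ∘ (true ∷_)) ≤_) (+-comm (∑ʷ (f ∘ (true ∷_))) (∑ʷ (f ∘ (false ∷_))))
                   (≤-+-nonneg _ (∑ʷ-nonneg _ (f≥0 ∘ (false ∷_)))))

module Spectrum {n : ℕ} (C : Code n) (u : Word n) where

  open import Data.Bool using (true; false; not; _∧_; _∨_; T)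
  open import Data.Nat using (ℕ; zero; suc; _≡ᵇ_; z≤n; s≤s)
  import Data.Nat.Properties as ℕ
  open import Data.Integer using (ℤ; +_; _+_; _*_; _≤_; _<_; 0ℤ; 1ℤ; +≤+; +<+)
  open import Data.Integer.Properties
  open import Data.Integer.Tactic.RingSolver using (solve-∀)
  open import Data.Fin using (Fin) renaming (zero to fzero; suc to fsuc)
  open import Data.List using (_∷_; foldr)
  open import Data.List.Membership.Propositional using (_∈_)
  open import Data.List.Relation.Unary.Any using (here; there)
  open import Relation.Binary.PropositionalEquality
  open import Algebra.Properties.Semiring.Sum +-*-semiring using (sum; sum-cong-≗; *-distribˡ-sum)
  import Algebra.Properties.Semiring.Sum ℕ.+-*-semiring as ℕΣ
  open Words
  open Levels using (bit; neighboursIn≡sum; distToCode≡0⇒∈; ∈⇒distToCode≡0)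
  open Characters

  pos-sum : ∀ {m} (f : Fin m → ℕ) → + ℕΣ.sum f ≡ sum (λ i → + f i)
  pos-sum {zero}  f = refl
  pos-sum {suc m} f = trans (pos-+ (f fzero) _) (cong (λ t → + f fzero + t) (pos-sum (λ i → f (fsuc i))))

  level-sum : ℕ → ℤ
  level-sum l = ∑ʷ (λ x → + bit (distToCode C x ≡ᵇ l) * χ u x)

  θ-eigen : ∀ l → θ u * level-sum l ≡ ∑ʷ (λ y → χ u y * + neighboursIn C y l)
  θ-eigen l = begin
    θ u * level-sum l
      ≡⟨ *-distribˡ-∑ʷ (θ u) (λ x → I x * χ u x) ⟩
    ∑ʷ (λ x → θ u * (I x * χ u x))
      ≡⟨ ∑ʷ-cong (λ x → trans (regroup (θ u) (I x) (χ u x)) (cong (I x *_) (sym (∑-χ-toggle u x)))) ⟩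
    ∑ʷ (λ x → I x * sum (λ i → χ u (toggle x i)))
      ≡⟨ ∑ʷ-cong (λ x → *-distribˡ-sum (I x) (λ i → χ u (toggle x i))) ⟩
    ∑ʷ (λ x → sum (λ i → I x * χ u (toggle x i)))
      ≡⟨ ∑ʷ-sum-comm (λ x i → I x * χ u (toggle x i)) ⟩
    sum (λ i → ∑ʷ (λ x → I x * χ u (toggle x i)))
      ≡⟨ sum-cong-≗ toggle-variable ⟩
    sum (λ i → ∑ʷ (λ y → I (toggle y i) * χ u y))
      ≡⟨ ∑ʷ-sum-comm (λ y i → I (toggle y i) * χ u y) ⟨
    ∑ʷ (λ y → sum (λ i → I (toggle y i) * χ u y))
      ≡⟨ ∑ʷ-cong count-neighbours ⟩
    ∑ʷ (λ y → χ u y * + neighboursIn C y l) ∎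
    where
    open ≡-Reasoning
    I : Word n → ℤ
    I x = + bit (distToCode C x ≡ᵇ l)
    regroup : ∀ t a c → t * (a * c) ≡ a * (t * c)
    regroup = solve-∀
    toggle-variable : ∀ i → ∑ʷ (λ x → I x * χ u (toggle x i)) ≡ ∑ʷ (λ y → I (toggle y i) * χ u y)
    toggle-variable i =
      trans (∑ʷ-cong (λ x → cong (λ z → I z * χ u (toggle x i)) (sym (toggle-involutive x i))))
            (∑ʷ-toggle (λ y → I (toggle y i) * χ u y) i)
    count-neighbours : ∀ y → sum (λ i → I (toggle y i) * χ u y) ≡ χ u y * + neighboursIn C y l
    count-neighbours y = begin
      sum (λ i → I (toggle y i) * χ u y)
        ≡⟨ sum-cong-≗ (λ i → *-comm (I (toggle y i)) (χ u y)) ⟩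
      sum (λ i → χ u y * I (toggle y i))
        ≡⟨ *-distribˡ-sum (χ u y) (λ i → I (toggle y i)) ⟨
      χ u y * sum (λ i → I (toggle y i))
        ≡⟨ cong (χ u y *_) (sym (trans (cong +_ (neighboursIn≡sum C y l))
                                         (pos-sum (λ i → bit (distToCode C (toggle y i) ≡ᵇ l))))) ⟩
      χ u y * + neighboursIn C y l ∎

  ∈dual⇒orthogonal : dual C u ≡ true → ∀ c → C c ≡ true → dot c u ≡ false
  ∈dual⇒orthogonal u∈C⊥ c Cc = go (allWords n) u∈C⊥ (∈-allWords c)
    where
    go : ∀ ys → foldr (λ x acc → (not (C x) ∨ not (dot x u)) ∧ acc) true ys ≡ true → c ∈ ys → dot c u ≡ false
    go (y ∷ ys) all (there c∈ys) with not (C y) ∨ not (dot y u)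
    ... | true = go ys all c∈ys
    go (y ∷ ys) all (here refl) rewrite Cc with dot y u
    ... | false = refl

  level-sum-0-positive : dual C u ≡ true → ∀ {c₀} → C c₀ ≡ true → 0ℤ < level-sum 0
  level-sum-0-positive u∈C⊥ {c₀} Cc₀ =
    <-≤-trans (+<+ (s≤s z≤n)) (subst (_≤ level-sum 0) (term≡1 c₀ Cc₀) (term≤∑ʷ _ nonneg c₀))
    where
    term≡1 : ∀ c → C c ≡ true → + bit (distToCode C c ≡ᵇ 0) * χ u c ≡ 1ℤ
    term≡1 c Cc rewrite ∈⇒distToCode≡0 C c Cc | ∈dual⇒orthogonal u∈C⊥ c Cc = refl
    nonneg : ∀ x → 0ℤ ≤ + bit (distToCode C x ≡ᵇ 0) * χ u x
    nonneg x with distToCode C x ≡ᵇ 0 in eq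
    ... | false = +≤+ z≤n
    ... | true rewrite ∈dual⇒orthogonal u∈C⊥ x (distToCode≡0⇒∈ C Cc₀ x (ℕ.≡ᵇ⇒≡ _ 0 (subst T (sym eq) _))) = +≤+ z≤n

module Cubic where

  open import Data.Integer using (ℤ; +_; -_; _+_; _*_; _-_; _<_; 0ℤ; 1ℤ)
  open import Data.Integer.Properties
  open import Data.Integer.Tactic.RingSolver using (solve-∀)
  open import Data.Sum using (inj₁; inj₂)
  open import Data.Empty using (⊥-elim)
  open import Relation.Binary.PropositionalEquality
  open import Relation.Nullary using (yes; no)

  cubic : ℤ → ℤ → ℤ → ℤ
  cubic N s t = t * t * t + (N - s) * t * t - (s + 1ℤ) * t - N

  i*j≡0⇒j≡0 : ∀ {i j} → i ≢ 0ℤ → i * j ≡ 0ℤ → j ≡ 0ℤ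
  i*j≡0⇒j≡0 {i} i≢0 ij≡0 with i*j≡0⇒i≡0∨j≡0 i ij≡0
  ... | inj₁ i≡0 = ⊥-elim (i≢0 i≡0)
  ... | inj₂ j≡0 = j≡0

  ≢⇒-≢0 : ∀ {i j} → i ≢ j → i - j ≢ 0ℤ
  ≢⇒-≢0 {i} {j} i≢j eq = i≢j (i-j≡0⇒i≡j i j eq)

  vieta : ∀ {N s t₁ t₂ t₃} → t₁ ≢ t₂ → t₁ ≢ t₃ → t₂ ≢ t₃ →
          cubic N s t₁ ≡ 0ℤ → cubic N s t₂ ≡ 0ℤ → cubic N s t₃ ≡ 0ℤ → t₁ + t₂ + t₃ ≡ s - N
  vieta {N} {s} {t₁} {t₂} {t₃} t₁≢t₂ t₁≢t₃ t₂≢t₃ root₁ root₂ root₃ =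
    i-j≡0⇒i≡j _ _ (i*j≡0⇒j≡0 (≢⇒-≢0 t₂≢t₃) (trans (difference₂₃ t₁ t₂ t₃ N s) (cong₂ _-_ D₁₂ D₁₃)))
    where
    D : ℤ → ℤ → ℤ
    D x y = x * x + x * y + y * y + (N - s) * (x + y) - (s + 1ℤ)
    difference : ∀ x y N s → (x * x * x + (N - s) * x * x - (s + 1ℤ) * x - N)
                               - (y * y * y + (N - s) * y * y - (s + 1ℤ) * y - N)
                             ≡ (x - y) * (x * x + x * y + y * y + (N - s) * (x + y) - (s + 1ℤ))
    difference = solve-∀
    difference₂₃ : ∀ t₁ t₂ t₃ N s → (t₂ - t₃) * (t₁ + t₂ + t₃ - (s - N))
                     ≡ (t₁ * t₁ + t₁ * t₂ + t₂ * t₂ + (N - s) * (t₁ + t₂) - (s + 1ℤ))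
                       - (t₁ * t₁ + t₁ * t₃ + t₃ * t₃ + (N - s) * (t₁ + t₃) - (s + 1ℤ))
    difference₂₃ = solve-∀
    D₁₂ : D t₁ t₂ ≡ 0ℤ
    D₁₂ = i*j≡0⇒j≡0 (≢⇒-≢0 t₁≢t₂) (trans (sym (difference t₁ t₂ N s)) (cong₂ _-_ root₁ root₂))
    D₁₃ : D t₁ t₃ ≡ 0ℤ
    D₁₃ = i*j≡0⇒j≡0 (≢⇒-≢0 t₁≢t₃) (trans (sym (difference t₁ t₃ N s)) (cong₂ _-_ root₁ root₃))

  square-root-unique : ∀ {a b M} → a * a - M ≡ 0ℤ → b * b - M ≡ 0ℤ → a ≢ b → a ≡ - b
  square-root-unique {a} {b} {M} a²≡M b²≡M a≢b =
    i-j≡0⇒i≡j _ _ (trans (cong (λ c → a + c) (neg-involutive b))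
      (i*j≡0⇒j≡0 (≢⇒-≢0 a≢b) (trans (factor a b M) (cong₂ _-_ a²≡M b²≡M))))
    where factor : ∀ a b M → (a - b) * (a + b) ≡ (a * a - M) - (b * b - M)
          factor = solve-∀

  middle-root : ∀ {M y₁ y₂ y₃} → y₃ < y₂ → y₂ < y₁ → y₁ + y₂ + y₃ ≡ 0ℤ →
                y₁ * (y₁ * y₁ - M) ≡ 0ℤ → y₂ * (y₂ * y₂ - M) ≡ 0ℤ → y₃ * (y₃ * y₃ - M) ≡ 0ℤ → y₂ ≡ 0ℤ
  middle-root {M} {y₁} {y₂} {y₃} y₃<y₂ y₂<y₁ sum≡0 root₁ root₂ root₃ with y₂ ≟ 0ℤ | y₁ ≟ 0ℤ | y₃ ≟ 0ℤ
  ... | yes y₂≡0 | _ | _ = y₂≡0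
  ... | no _ | yes refl | _ =
    ⊥-elim (<-irrefl sum≡0 (+-mono-< (subst (_< 0ℤ) (sym (+-identityˡ y₂)) y₂<y₁) (<-trans y₃<y₂ y₂<y₁)))
  ... | no _ | no _ | yes refl =
    ⊥-elim (<-irrefl (sym sum≡0) (subst (0ℤ <_) (sym (+-identityʳ (y₁ + y₂))) (+-mono-< (<-trans y₃<y₂ y₂<y₁) y₃<y₂)))
  ... | no y₂≢0 | no y₁≢0 | no y₃≢0 = ⊥-elim (<-irrefl (trans y₃≡-y₂ (sym y₁≡-y₂)) (<-trans y₃<y₂ y₂<y₁))
    where
    y₂²≡M = i*j≡0⇒j≡0 y₂≢0 root₂
    y₁≡-y₂ = square-root-unique (i*j≡0⇒j≡0 y₁≢0 root₁) y₂²≡M (λ eq → <-irrefl (sym eq) y₂<y₁)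
    y₃≡-y₂ = square-root-unique (i*j≡0⇒j≡0 y₃≢0 root₃) y₂²≡M (λ eq → <-irrefl eq y₃<y₂)

module QuotientEigenvalues {n : ℕ} (C : Code n) (0∈C : C (zeroWord n) ≡ true) (ρ≡3 : coveringRadius C ≡ 3)
  (b₁ c₂ : ℕ) (cr : IsCompletelyRegularWithArray C (n ∷ b₁ ∷ 1 ∷ []) (1 ∷ c₂ ∷ n ∷ [])) where

  open import Data.Nat as ℕ using (ℕ; suc; _≡ᵇ_; _≤_; s≤s)
  import Data.Nat.Properties as ℕ
  open import Data.Integer using (ℤ; +_; -_; _+_; _*_; _-_; 0ℤ; 1ℤ)
  open import Data.Integer.Properties using (*-comm; *-zeroʳ; <-irrefl; i≡j⇒i-j≡0)
  open import Data.Integer.Tactic.RingSolver using (solve-∀)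
  open import Relation.Binary.PropositionalEquality
  open Levels using (bit)
  open Characters
  open CompletelyRegular C 0∈C ρ≡3 b₁ c₂ cr
  open Cubic

  ∑levelsℤ : (ℕ → ℤ) → ℤ
  ∑levelsℤ f = f 0 + (f 1 + (f 2 + f 3))

  split-levelℤ : ∀ {v} → v ≤ 3 → (h : ℕ → ℤ) (c : ℤ) → c * h v ≡ ∑levelsℤ (λ k → h k * (+ bit (v ≡ᵇ k) * c))
  split-levelℤ {0} _ h c = lemma (h 0) (h 1) (h 2) (h 3) c
    where lemma : ∀ a b d e c → c * a ≡ a * (+ 1 * c) + (b * (+ 0 * c) + (d * (+ 0 * c) + e * (+ 0 * c)))
          lemma = solve-∀
  split-levelℤ {1} _ h c = lemma (h 0) (h 1) (h 2) (h 3) c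
    where lemma : ∀ a b d e c → c * b ≡ a * (+ 0 * c) + (b * (+ 1 * c) + (d * (+ 0 * c) + e * (+ 0 * c)))
          lemma = solve-∀
  split-levelℤ {2} _ h c = lemma (h 0) (h 1) (h 2) (h 3) c
    where lemma : ∀ a b d e c → c * d ≡ a * (+ 0 * c) + (b * (+ 0 * c) + (d * (+ 1 * c) + e * (+ 0 * c)))
          lemma = solve-∀
  split-levelℤ {3} _ h c = lemma (h 0) (h 1) (h 2) (h 3) c
    where lemma : ∀ a b d e c → c * e ≡ a * (+ 0 * c) + (b * (+ 0 * c) + (d * (+ 0 * c) + e * (+ 1 * c)))
          lemma = solve-∀
  split-levelℤ {suc (suc (suc (suc _)))} (s≤s (s≤s (s≤s ()))) h c

  ∑ʷ-∑levelsℤ : (G : ℕ → Word n → ℤ) → ∑ʷ (λ y → ∑levelsℤ (λ k → G k y)) ≡ ∑levelsℤ (λ k → ∑ʷ (G k))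
  ∑ʷ-∑levelsℤ G =
    trans (∑ʷ-distrib-+ (G 0) (λ y → G 1 y + (G 2 y + G 3 y)))
          (cong (λ t → ∑ʷ (G 0) + t) (trans (∑ʷ-distrib-+ (G 1) (λ y → G 2 y + G 3 y))
                (cong (λ t → ∑ʷ (G 1) + t) (∑ʷ-distrib-+ (G 2) (G 3)))))

  charPoly : (N b c A₁ A₂ t : ℤ) → ℤ
  charPoly N b c A₁ A₂ t = (t * t - A₁ * t - N) * (t * t - A₂ * t - N) - b * c * (t * t)

  -- The rows are the eigen-equations of the quotient matrix; the multipliers in `combination`
  -- eliminate F₁, F₂ and F₃.
  characteristic : ∀ {t N A₁ A₂ b c F₀ F₁ F₂ F₃} →
    t * F₀ ≡ + 0 * F₀ + (+ 1 * F₁ + (+ 0 * F₂ + + 0 * F₃)) →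
    t * F₁ ≡ N * F₀ + (A₁ * F₁ + (c * F₂ + + 0 * F₃)) →
    t * F₂ ≡ + 0 * F₀ + (b * F₁ + (A₂ * F₂ + N * F₃)) →
    t * F₃ ≡ + 0 * F₀ + (+ 0 * F₁ + (+ 1 * F₂ + + 0 * F₃)) →
    charPoly N b c A₁ A₂ t * F₀ ≡ 0ℤ
  characteristic {t} {N} {A₁} {A₂} {b} {c} {F₀} {F₁} {F₂} {F₃} row₀ row₁ row₂ row₃ =
    trans (combination t N A₁ A₂ b c F₀ F₁ F₂ F₃)
          (vanishes ((t * t - A₂ * t - N) * (t - A₁) - c * b * t) (t * t - A₂ * t - N) (c * t) (c * N)
                    (i≡j⇒i-j≡0 row₀) (i≡j⇒i-j≡0 row₁) (i≡j⇒i-j≡0 row₂) (i≡j⇒i-j≡0 row₃))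
    where
    combination : ∀ t N A₁ A₂ b c F₀ F₁ F₂ F₃ →
      ((t * t - A₁ * t - N) * (t * t - A₂ * t - N) - b * c * (t * t)) * F₀ ≡
        ((t * t - A₂ * t - N) * (t - A₁) - c * b * t) * (t * F₀ - (+ 0 * F₀ + (+ 1 * F₁ + (+ 0 * F₂ + + 0 * F₃))))
        + (t * t - A₂ * t - N) * (t * F₁ - (N * F₀ + (A₁ * F₁ + (c * F₂ + + 0 * F₃))))
        + c * t * (t * F₂ - (+ 0 * F₀ + (b * F₁ + (A₂ * F₂ + N * F₃))))
        + c * N * (t * F₃ - (+ 0 * F₀ + (+ 0 * F₁ + (+ 1 * F₂ + + 0 * F₃))))
    combination = solve-∀
    vanishes : ∀ λ₀ λ₁ λ₂ λ₃ {x₀ x₁ x₂ x₃} → x₀ ≡ 0ℤ → x₁ ≡ 0ℤ → x₂ ≡ 0ℤ → x₃ ≡ 0ℤ →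
               λ₀ * x₀ + λ₁ * x₁ + λ₂ * x₂ + λ₃ * x₃ ≡ 0ℤ
    vanishes λ₀ λ₁ λ₂ λ₃ refl refl refl refl =
      cong₂ _+_ (cong₂ _+_ (cong₂ _+_ (*-zeroʳ λ₀) (*-zeroʳ λ₁)) (*-zeroʳ λ₂)) (*-zeroʳ λ₃)

  charPoly-factor : ∀ N b c t →
    charPoly N b c (N - (1ℤ + b)) (N - (c + 1ℤ)) t ≡ (t - N) * cubic N ((N - (1ℤ + b)) + (N - (c + 1ℤ))) t
  charPoly-factor = factor
    where
    factor : ∀ N b c t →
      (t * t - (N - (1ℤ + b)) * t - N) * (t * t - (N - (c + 1ℤ)) * t - N) - b * c * (t * t)
        ≡ (t - N) * (t * t * t + (N - ((N - (1ℤ + b)) + (N - (c + 1ℤ)))) * t * t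
                     - (((N - (1ℤ + b)) + (N - (c + 1ℤ))) + 1ℤ) * t - N)
    factor = solve-∀

  s : ℤ
  s = (+ n - (1ℤ + + b₁)) + (+ n - (+ c₂ + 1ℤ))

  +a₁ : + a₁ ≡ + n - (1ℤ + + b₁)
  +a₁ = trans (shift (+ a₁) (+ b₁)) (cong (_- (1ℤ + + b₁)) (cong +_ c₁+a₁+b₁≡n))
    where shift : ∀ a b → a ≡ (1ℤ + (a + (b + 0ℤ))) - (1ℤ + b)
          shift = solve-∀

  +a₂ : + a₂ ≡ + n - (+ c₂ + 1ℤ)
  +a₂ = trans (shift (+ a₂) (+ c₂)) (cong (_- (+ c₂ + 1ℤ)) (cong +_ c₂+a₂+b₂≡n))
    where shift : ∀ a c → a ≡ (c + (a + 1ℤ)) - (c + 1ℤ)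
          shift = solve-∀

  module _ (u : Word n) where

    open Spectrum C u

    quotient-eigen : ∀ L → θ u * level-sum L ≡ ∑levelsℤ (λ k → + quotient k L * level-sum k)
    quotient-eigen L = begin
      θ u * level-sum L
        ≡⟨ θ-eigen L ⟩
      ∑ʷ (λ y → χ u y * + neighboursIn C y L)
        ≡⟨ ∑ʷ-cong (λ y → cong (λ m → χ u y * + m) (neighbours≡quotient y L)) ⟩
      ∑ʷ (λ y → χ u y * + quotient (level y) L)
        ≡⟨ ∑ʷ-cong (λ y → split-levelℤ (level≤3 y) (λ k → + quotient k L) (χ u y)) ⟩
      ∑ʷ (λ y → ∑levelsℤ (λ k → + quotient k L * (I k y * χ u y)))
        ≡⟨ ∑ʷ-∑levelsℤ (λ k y → + quotient k L * (I k y * χ u y)) ⟩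
      ∑levelsℤ (λ k → ∑ʷ (λ y → + quotient k L * (I k y * χ u y)))
        ≡⟨ cong₂ _+_ (pull 0) (cong₂ _+_ (pull 1) (cong₂ _+_ (pull 2) (pull 3))) ⟩
      ∑levelsℤ (λ k → + quotient k L * level-sum k) ∎
      where
      open ≡-Reasoning
      I : ℕ → Word n → ℤ
      I k y = + bit (level y ≡ᵇ k)
      pull : ∀ k → ∑ʷ (λ y → + quotient k L * (I k y * χ u y)) ≡ + quotient k L * level-sum k
      pull k = sym (*-distribˡ-∑ʷ (+ quotient k L) (λ y → I k y * χ u y))

    θ-root : dual C u ≡ true → 0 ℕ.< weight u → cubic (+ n) s (θ u) ≡ 0ℤ
    θ-root u∈C⊥ w>0 = i*j≡0⇒j≡0 (≢⇒-≢0 (θ≢length u w>0)) (begin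
      (θ u - + n) * cubic (+ n) s (θ u)
        ≡⟨ charPoly-factor (+ n) (+ b₁) (+ c₂) (θ u) ⟨
      charPoly (+ n) (+ b₁) (+ c₂) (+ n - (1ℤ + + b₁)) (+ n - (+ c₂ + 1ℤ)) (θ u)
        ≡⟨ cong₂ (λ A₁ A₂ → charPoly (+ n) (+ b₁) (+ c₂) A₁ A₂ (θ u)) +a₁ +a₂ ⟨
      charPoly (+ n) (+ b₁) (+ c₂) (+ a₁) (+ a₂) (θ u)
        ≡⟨ i*j≡0⇒j≡0 level-sum-0≢0 (trans (*-comm (level-sum 0) _) annihilated) ⟩
      0ℤ ∎)
      where
      open ≡-Reasoning
      annihilated = characteristic {θ u} {+ n} {+ a₁} {+ a₂} {+ b₁} {+ c₂}
                      (quotient-eigen 0) (quotient-eigen 1) (quotient-eigen 2) (quotient-eigen 3)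
      level-sum-0≢0 : level-sum 0 ≢ 0ℤ
      level-sum-0≢0 eq = <-irrefl (sym eq) (level-sum-0-positive u∈C⊥ 0∈C)

module DualWeights {n : ℕ} (C : Code n) (0∈C : C (zeroWord n) ≡ true) (ρ≡3 : coveringRadius C ≡ 3)
  (b₁ c₂ : ℕ) (cr : IsCompletelyRegularWithArray C (n ∷ b₁ ∷ 1 ∷ []) (1 ∷ c₂ ∷ n ∷ []))
  {w₁ w₂ w₃ : ℕ} (W : HasExactlyThreeNonzeroWeights (dual C) w₁ w₂ w₃) where

  open import Data.Nat as ℕ using (ℕ; suc)
  import Data.Nat.Properties as ℕₚ
  open import Data.Integer using (ℤ; +_; -_; _+_; _-_; _*_; _<_; 0ℤ; 1ℤ; +<+)
  open import Data.Integer.Properties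
    using (+-injective; +-identityʳ; +-mono-<; +-monoʳ-<; +-monoˡ-<; neg-mono-<; <-irrefl; i-j≡0⇒i≡j)
  open import Data.Integer.Tactic.RingSolver using (solve-∀)
  open import Data.Product using (_×_; _,_; Σ; proj₁; proj₂)
  open import Relation.Binary.PropositionalEquality
  open Words using (weight≡0⇒≡zeroWord)
  open Characters using (θ≡n-2weight)
  open Cubic
  open QuotientEigenvalues C 0∈C ρ≡3 b₁ c₂ cr using (s; θ-root)

  N : ℤ
  N = + n

  τ : ℕ → ℤ
  τ w = N - + w - + w

  τ-root : ∀ w → (Σ (Word n) λ y → dual C y ≡ true × y ≢ zeroWord n × weight y ≡ w) → cubic N s (τ w) ≡ 0ℤ
  τ-root w (y , y∈C⊥ , y≢0 , refl) =
    subst (λ t → cubic N s t ≡ 0ℤ) (θ≡n-2weight y)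
          (θ-root y y∈C⊥ (ℕₚ.n≢0⇒n>0 (λ w≡0 → y≢0 (weight≡0⇒≡zeroWord y w≡0))))

  τ-anti : ∀ {w w′} → w ℕ.< w′ → τ w′ < τ w
  τ-anti w<w′ = +-mono-< (+-monoʳ-< N −w′<−w) −w′<−w
    where −w′<−w = neg-mono-< (+<+ w<w′)

  τ-injective : ∀ {w w′} → w ℕ.< w′ → τ w ≢ τ w′
  τ-injective w<w′ eq = <-irrefl (sym eq) (τ-anti w<w′)

  w₁<w₂ : w₁ ℕ.< w₂
  w₁<w₂ = proj₁ W

  w₂<w₃ : w₂ ℕ.< w₃
  w₂<w₃ = proj₁ (proj₂ W)

  root₁ : cubic N s (τ w₁) ≡ 0ℤ
  root₁ = τ-root w₁ (proj₁ (proj₂ (proj₂ (proj₂ W))))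

  root₂ : cubic N s (τ w₂) ≡ 0ℤ
  root₂ = τ-root w₂ (proj₁ (proj₂ (proj₂ (proj₂ (proj₂ W)))))

  root₃ : cubic N s (τ w₃) ≡ 0ℤ
  root₃ = τ-root w₃ (proj₂ (proj₂ (proj₂ (proj₂ (proj₂ W)))))

  sum-of-roots : τ w₁ + τ w₂ + τ w₃ ≡ s - N
  sum-of-roots = vieta {N} {s} (τ-injective w₁<w₂) (τ-injective (ℕₚ.<-trans w₁<w₂ w₂<w₃)) (τ-injective w₂<w₃)
                       root₁ root₂ root₃

  weights⇒b₁+c₂≡n+1 : w₁ ℕ.+ w₃ ≡ 2 ℕ.* w₂ × 2 ℕ.* w₂ ≡ n ℕ.+ 1 → b₁ ℕ.+ c₂ ≡ n ℕ.+ 1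
  weights⇒b₁+c₂≡n+1 (w₁+w₃≡2w₂ , 2w₂≡n+1) = +-injective (begin
    + b₁ + + c₂
      ≡⟨ b+c≡ (+ b₁) (+ c₂) N ⟩
    N - + 2 - (s - N)
      ≡⟨ cong (λ x → N - + 2 - x) sum-of-roots ⟨
    N - + 2 - (τ w₁ + τ w₂ + τ w₃)
      ≡⟨ expand (+ w₁) (+ w₂) (+ w₃) N ⟩
    + (w₁ ℕ.+ w₃) + + (w₁ ℕ.+ w₃) + + (2 ℕ.* w₂) - (N + N) - + 2
      ≡⟨ cong (λ x → x + x + + (2 ℕ.* w₂) - (N + N) - + 2) (cong +_ w₁+w₃≡2w₂) ⟩
    + (2 ℕ.* w₂) + + (2 ℕ.* w₂) + + (2 ℕ.* w₂) - (N + N) - + 2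
      ≡⟨ cong (λ y → y + y + y - (N + N) - + 2) (cong +_ 2w₂≡n+1) ⟩
    (N + 1ℤ) + (N + 1ℤ) + (N + 1ℤ) - (N + N) - + 2
      ≡⟨ simplify N ⟩
    N + 1ℤ ∎)
    where
    open ≡-Reasoning
    b+c≡ : ∀ b c N → b + c ≡ N - + 2 - (((N - (1ℤ + b)) + (N - (c + 1ℤ))) - N)
    b+c≡ = solve-∀
    expand : ∀ a b c N → N - + 2 - ((N - a - a) + (N - b - b) + (N - c - c))
                         ≡ (a + c) + (a + c) + (b + (b + 0ℤ)) - (N + N) - + 2
    expand = solve-∀
    simplify : ∀ N → (N + 1ℤ) + (N + 1ℤ) + (N + 1ℤ) - (N + N) - + 2 ≡ N + 1ℤ
    simplify = solve-∀

  b₁+c₂≡n+1⇒weights : b₁ ℕ.+ c₂ ≡ n ℕ.+ 1 → w₁ ℕ.+ w₃ ≡ 2 ℕ.* w₂ × 2 ℕ.* w₂ ≡ n ℕ.+ 1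
  b₁+c₂≡n+1⇒weights b₁+c₂≡n+1 = trans w₁+w₃≡n+1 (sym 2w₂≡n+1) , 2w₂≡n+1
    where
    open ≡-Reasoning
    s≡N-3 : s ≡ N - + 3
    s≡N-3 = begin
      s                                  ≡⟨ regroup (+ b₁) (+ c₂) N ⟩
      N + N - + 2 - (+ b₁ + + c₂)        ≡⟨ cong (λ x → N + N - + 2 - x) (cong +_ b₁+c₂≡n+1) ⟩
      N + N - + 2 - (N + 1ℤ)             ≡⟨ simplify N ⟩
      N - + 3                            ∎
      where
      regroup : ∀ b c N → (N - (1ℤ + b)) + (N - (c + 1ℤ)) ≡ N + N - + 2 - (b + c)
      regroup = solve-∀
      simplify : ∀ N → N + N - + 2 - (N + 1ℤ) ≡ N - + 3
      simplify = solve-∀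
    -- In υ = τ + 1 the cubic becomes υ (υ² - (n + 1)), whose roots sum to 0.
    υ : ℕ → ℤ
    υ w = τ w + 1ℤ
    υ-root : ∀ w → cubic N s (τ w) ≡ 0ℤ → υ w * (υ w * υ w - (N + 1ℤ)) ≡ 0ℤ
    υ-root w root = trans (shifted (τ w) N) (subst (λ σ → cubic N σ (τ w) ≡ 0ℤ) s≡N-3 root)
      where shifted : ∀ t N → (t + 1ℤ) * ((t + 1ℤ) * (t + 1ℤ) - (N + 1ℤ))
                              ≡ t * t * t + (N - (N - + 3)) * t * t - ((N - + 3) + 1ℤ) * t - N
            shifted = solve-∀
    υ-sum : υ w₁ + υ w₂ + υ w₃ ≡ 0ℤ
    υ-sum = begin
      υ w₁ + υ w₂ + υ w₃            ≡⟨ regroup (τ w₁) (τ w₂) (τ w₃) ⟩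
      τ w₁ + τ w₂ + τ w₃ + + 3      ≡⟨ cong (_+ + 3) (trans sum-of-roots (cong (_- N) s≡N-3)) ⟩
      N - + 3 - N + + 3             ≡⟨ simplify N ⟩
      0ℤ                            ∎
      where
      regroup : ∀ a b c → (a + 1ℤ) + (b + 1ℤ) + (c + 1ℤ) ≡ a + b + c + + 3
      regroup = solve-∀
      simplify : ∀ N → N - + 3 - N + + 3 ≡ 0ℤ
      simplify = solve-∀
    υ₂≡0 : υ w₂ ≡ 0ℤ
    υ₂≡0 = middle-root (+-monoˡ-< 1ℤ (τ-anti w₂<w₃)) (+-monoˡ-< 1ℤ (τ-anti w₁<w₂)) υ-sum
             (υ-root w₁ root₁) (υ-root w₂ root₂) (υ-root w₃ root₃)
    2w₂≡n+1 : 2 ℕ.* w₂ ≡ n ℕ.+ 1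
    2w₂≡n+1 = +-injective (begin
      + w₂ + (+ w₂ + 0ℤ)            ≡⟨ regroup (+ w₂) N ⟩
      N + 1ℤ - υ w₂                 ≡⟨ cong (λ x → N + 1ℤ - x) υ₂≡0 ⟩
      N + 1ℤ - 0ℤ                   ≡⟨ +-identityʳ (N + 1ℤ) ⟩
      N + 1ℤ                        ∎)
      where regroup : ∀ w N → w + (w + 0ℤ) ≡ N + 1ℤ - (N - w - w + 1ℤ)
            regroup = solve-∀
    w₁+w₃≡n+1 : w₁ ℕ.+ w₃ ≡ n ℕ.+ 1
    w₁+w₃≡n+1 = +-injective (i-j≡0⇒i≡j _ _ (i*j≡0⇒j≡0 {+ 2} (λ ()) (begin
      + 2 * (+ w₁ + + w₃ - (N + 1ℤ))  ≡⟨ regroup (+ w₁) (+ w₂) (+ w₃) N ⟩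
      - (υ w₁ + υ w₂ + υ w₃) + υ w₂   ≡⟨ cong₂ (λ x y → - x + y) υ-sum υ₂≡0 ⟩
      0ℤ                              ∎)))
      where regroup : ∀ a b c N → + 2 * (a + c - (N + 1ℤ))
                                  ≡ - ((N - a - a + 1ℤ) + (N - b - b + 1ℤ) + (N - c - c + 1ℤ)) + (N - b - b + 1ℤ)
            regroup = solve-∀

open import Data.Nat using (suc; _+_; _*_; _∸_; _^_; _≤_)
open import Data.Product using (_×_; _,_; proj₁)
open import Function.Bundles using (_⇔_; mk⇔)

extendedCode-completelyRegular⇔ : ∀ {n} (C : Code n) (b₁ c₂ w₁ w₂ w₃ : ℕ) →
  C (zeroWord n) ≡ true →
  coveringRadius C ≡ 3 →
  IsCompletelyRegularWithArray C (n ∷ b₁ ∷ 1 ∷ []) (1 ∷ c₂ ∷ n ∷ []) →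
  HasExactlyThreeNonzeroWeights (dual C) w₁ w₂ w₃ →
  ((coveringRadius (extendedCode C) ≡ 4
      × IsCompletelyRegularWithArray (extendedCode C) (suc n ∷ n ∷ b₁ ∷ 1 ∷ []) (1 ∷ c₂ ∷ n ∷ suc n ∷ []))
    ⇔ (w₁ + w₃ ≡ 2 * w₂ × 2 * w₂ ≡ n + 1))
extendedCode-completelyRegular⇔ C b₁ c₂ w₁ w₂ w₃ 0∈C ρ≡3 cr W = mk⇔
  (λ (_ , cr*) → b₁+c₂≡n+1⇒weights (extended-completelyRegular⇒ cr*))
  (λ weights → coveringRadius-extended , extended-completelyRegular (weights⇒b₁+c₂≡n+1 weights))
  where
  open ExtendedCompletelyRegular C 0∈C ρ≡3 b₁ c₂ cr
  open DualWeights C 0∈C ρ≡3 b₁ c₂ cr W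

lemma6 : (m : ℕ) → 2 ≤ m →
    (C : Code (2 ^ m ∸ 1)) → (b₁ c₂ w₁ w₂ w₃ : ℕ) →
    IsLinear C →
    HasMinDistance C 3 →
    coveringRadius C ≡ 3 →
    IsCompletelyRegularWithArray C
      ((2 ^ m ∸ 1) ∷ b₁ ∷ 1 ∷ []) (1 ∷ c₂ ∷ (2 ^ m ∸ 1) ∷ []) →
    HasExactlyThreeNonzeroWeights (dual C) w₁ w₂ w₃ →
    ((coveringRadius (extendedCode C) ≡ 4
        × IsCompletelyRegularWithArray (extendedCode C)
            (suc (2 ^ m ∸ 1) ∷ (2 ^ m ∸ 1) ∷ b₁ ∷ 1 ∷ [])
            (1 ∷ c₂ ∷ (2 ^ m ∸ 1) ∷ suc (2 ^ m ∸ 1) ∷ []))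
      ⇔ (w₁ + w₃ ≡ 2 * w₂ × 2 * w₂ ≡ (2 ^ m ∸ 1) + 1))
lemma6 m _ C b₁ c₂ w₁ w₂ w₃ linear _ ρ≡3 cr W =
  extendedCode-completelyRegular⇔ C b₁ c₂ w₁ w₂ w₃ (proj₁ linear) ρ≡3 cr W
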